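{- Let $n\ge 2$ and let $\tilde s=(\tilde s_1,\dots,\tilde s_n)\in\{0,1\}^n$. Let $G$ be the threshold graph with self-loops with creation sequence $\tilde s$: the graph on $\{1,\dots,n\}$ whose adjacency matrix $\tilde A$ is given by $\tilde A_{ij}=\tilde s_{\max(i,j)}$ for all $i,j$ (so vertex $i$ carries a self-loop iff $\tilde s_i=1$, and for $i<j$ the vertices $i,j$ are adjacent iff $\tilde s_j=1$). Write $\tilde s$ uniquely in run form \[ \tilde s=(\underbrace{1,\dots,1}_{k_1},\underbrace{0,\dots,0}_{l_1},\dots,\underbrace{1,\dots,1}_{k_m},\underbrace{0,\dots,0}_{l_m}), \] where $m\ge1$, $k_1,l_m\ge0$ and $k_2,\dots,k_m,l_1,\dots,l_{m-1}\ge1$. Set \[ \widetilde C_n(0)=n-2(m-1)-I_{\{1\}}(\tilde s_1),\qquad J=2(m-1)+I_{\{1\}}(\tilde s_1). \] Define $(a_1,\dots,a_J)$ by $a_{2r-1}=k_{m-r+1}$ and $a_{2r}=l_{m-r}$ for all indices in $\{1,\dots,J\}$ (so $(a_1,\dots,a_J)=(k_m,l_{m-1},k_{m-1},\dots,l_1,k_1)$ if $\tilde s_1=1$ and $(k_m,l_{m-1},k_{m-1},\dots,k_2,l_1)$ if $\tilde s_1=0$). Let $B$ be the $J\times J$ matrix with entries: for odd $p$, $B_{pq}=a_q$ if $q\ge p$, and for $q<p$, $B_{pq}=a_q$ if $q$ is odd and $B_{pq}=0$ if $q$ is even; for even $p$, $B_{pq}=a_q$ if $q<p$ and $q$ is odd,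 and $B_{pq}=0$ otherwise. Let $\lambda_1,\dots,\lambda_J$ be the eigenvalues of $B$ counted with algebraic multiplicity. Then the spectral distribution of $G$ is \[ \widetilde\mu_n(G)=\frac{\widetilde C_n(0)}{n}\,\delta_0+\frac1n\sum_{j=1}^J\delta_{\lambda_j}, \] and moreover every $\lambda_j$ is different from $0$.
   Context: The spectral distribution of a graph (possibly with self-loops) on $n$ vertices with adjacency matrix $\tilde A$ is $\frac1n\sum_{i=1}^n\delta_{\mu_i}$, where $\mu_1,\dots,\mu_n$ are the eigenvalues of $\tilde A$ with multiplicity; $\delta_x$ is the Dirac measure at $x$ and $I_{\{1\}}(\tilde s_1)$ equals $1$ if $\tilde s_1=1$ and $0$ otherwise. -}

module Defs where

open import Data.Bool using (Bool; true; false; if_then_else_; _∧_)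
open import Data.Nat as ℕ using (ℕ; zero; suc; _∸_; _≤ᵇ_; _<ᵇ_)
open import Data.Integer as ℤ using (ℤ; +_; -_)
open import Data.Fin as Fin using (Fin; toℕ; punchIn)
open import Data.List as List using (List; []; _∷_; _++_; replicate; concatMap; length)
open import Data.Vec as Vec using (Vec)
open import Data.Product using (_×_; _,_)
open import Relation.Nullary using (does)

-- Polynomials with integer coefficients, as coefficient lists
-- (constant coefficient first).  Equality is coefficientwise, so
-- trailing zeros do not matter.

Poly : Set
Poly = List ℤ

coeff : Poly → ℕ → ℤ
coeff []       _       = + 0
coeff (a ∷ p)  zero    = a
coeff (a ∷ p)  (suc i) = coeff p i

infix 4 _≈P_
_≈P_ : Poly → Poly → Set
p ≈P q = ∀ i → coeff p i ≡ coeff q i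
  where open import Relation.Binary.PropositionalEquality using (_≡_)

infixl 6 _+P_ _-P_
infixl 7 _*P_

_+P_ : Poly → Poly → Poly
[]      +P q       = q
p       +P []      = p
(a ∷ p) +P (b ∷ q) = (a ℤ.+ b) ∷ (p +P q)

negP : Poly → Poly
negP = List.map (-_)

_-P_ : Poly → Poly → Poly
p -P q = p +P negP q

_*P_ : Poly → Poly → Poly
[]      *P q = []
(a ∷ p) *P q = List.map (a ℤ.*_) q +P (+ 0 ∷ (p *P q))

constP : ℤ → Poly
constP a = a ∷ []

X : Poly
X = + 0 ∷ + 1 ∷ []

Xpow : ℕ → Poly
Xpow zero    = constP (+ 1)
Xpow (suc c) = X *P Xpow c

isEven : ℕ → Bool
isEven zero          = true
isEven (suc zero)    = false
isEven (suc (suc n)) = isEven n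

sumP : ∀ {n} → (Fin n → Poly) → Poly
sumP {zero}  f = []
sumP {suc n} f = f Fin.zero +P sumP (λ j → f (Fin.suc j))

det : ∀ {n} → (Fin n → Fin n → Poly) → Poly
det {zero}  M = constP (+ 1)
det {suc n} M =
  sumP (λ j → constP (if isEven (toℕ j) then + 1 else - + 1)
              *P (M Fin.zero j *P det (λ r c → M (Fin.suc r) (punchIn j c))))

charPoly : ∀ {n} → (Fin n → Fin n → ℤ) → Poly
charPoly M = det (λ i j → (if does (i Fin.≟ j) then X else []) -P constP (M i j))

maxFin : ∀ {n} → Fin n → Fin n → Fin n
maxFin i j = if toℕ i ≤ᵇ toℕ j then j else i

boolℤ : Bool → ℤ
boolℤ true  = + 1
boolℤ false = + 0

adjTilde : (s : List Bool) → Fin (length s) → Fin (length s) → ℤ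
adjTilde s i j = boolℤ (List.lookup s (maxFin i j))

ind₁ : List Bool → ℕ
ind₁ (true ∷ _) = 1
ind₁ _          = 0

runs : ∀ {m} → Vec ℕ m → Vec ℕ m → List Bool
runs k l = List.concat (Vec.toList (Vec.zipWith (λ a b → replicate a true ++ replicate b false) k l))

-- the list (k_m, l_{m-1}, k_{m-1}, …, l_1, k_1)
aList : ∀ {m} → Vec ℕ m → Vec ℕ m → List ℕ
aList k l = go (Vec.toList (Vec.reverse (Vec.zip k l)))
  where
  go : List (ℕ × ℕ) → List ℕ
  go []              = []
  go ((km , _) ∷ rs) = km ∷ concatMap (λ { (ki , li) → li ∷ ki ∷ [] }) rs

nth : List ℕ → ℕ → ℕ
nth []      _       = 0
nth (x ∷ _) zero    = x
nth (_ ∷ x) (suc i) = nth x i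

-- J = 2(m−1) + I_{1}(s̃₁), with m = suc m'
Jdim : (s : List Bool) (m' : ℕ) → ℕ
Jdim s m' = 2 ℕ.* m' ℕ.+ ind₁ s

-- a_p (1-based p ↔ 0-based index toℕ p)
aSeq : ∀ {m J} → Vec ℕ m → Vec ℕ m → Fin J → ℕ
aSeq k l p = nth (aList k l) (toℕ p)

-- the matrix B (0-based indices; "p odd" in 1-based ↔ toℕ p even)
Bmat : ∀ {m J} → Vec ℕ m → Vec ℕ m → Fin J → Fin J → ℤ
Bmat k l p q =
  if isEven (toℕ p)
  then (if toℕ p ≤ᵇ toℕ q then + aSeq k l q
        else (if isEven (toℕ q) then + aSeq k l q else + 0))
  else (if (toℕ q <ᵇ toℕ p) ∧ isEven (toℕ q) then + aSeq k l q else + 0)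

-- Both characteristic polynomials obey first-order linear recurrences.
-- For the threshold graph put Δ(s) = χ(s) − X·χ(tail s); subtracting row 1
-- from row 0 of X·I − Ã gives Δ(b c t) = (c − b)·χ(c t) + X·Δ(c t), so a run
-- of r+1 equal bits only contributes powers of X and the single number r+1.
-- For B, subtracting the penultimate row from the last one and expanding
-- along it gives χ_{J+1} = (X ∓ a_J)·χ_J − a_J·X·ω_J and
-- ω_{J+1} = X·ω_J ± χ_J for an auxiliary minor ω.  Reading the creation
-- sequence from the right, run by run, the two recurrences coincide up to
-- powers of X, whence det(X·I − Ã) = X^{n−J}·det(X·I − B).  Finally the
-- constant term of det(X·I − B) is ±a₀⋯a_{J−1} ≠ 0.

module Submission where

open import Defs
open import Algebra.Bundles using (CommutativeRing)
open import Algebra.Structures using (IsCommutativeRing)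
open import Data.Bool using (Bool; true; false; if_then_else_; not; _∧_)
open import Data.Empty using (⊥-elim)
open import Data.Fin as Fin using (Fin; zero; suc; toℕ; punchIn; inject₁; fromℕ)
open import Data.Fin.Properties using (toℕ-fromℕ; toℕ-inject₁; toℕ<n; suc-injective; fromℕ≢inject₁)
open import Data.Integer as ℤ using (ℤ; +_; -_)
import Data.Integer.Properties as ℤ
import Data.Integer.Tactic.RingSolver as ℤ-Solver
open import Data.List as List using (List; []; _∷_; _++_; length; replicate)
import Data.List.Properties as List
open import Data.Maybe as Maybe using (Maybe; just; nothing)
open import Data.Nat as ℕ using (ℕ; zero; suc; _≤_; _<_; _∸_; z≤n; s≤s)
import Data.Nat.Properties as ℕ
open import Data.Product using (_×_; _,_)
open import Data.Sum using (_⊎_; inj₁; inj₂)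
open import Data.Vec as Vec using (Vec; lookup; _∷_; [])
import Data.Vec.Properties as VecP
open import Data.Vec.Functional using (updateAt)
open import Data.Vec.Functional.Properties
  using (updateAt-updates; updateAt-minimal; updateAt-id-local; map-updateAt-local)
open import Function using (const; _∘_; case_of_)
open import Relation.Binary.Bundles using (Setoid)
open import Relation.Binary.Definitions using (tri<; tri≈; tri>)
open import Relation.Binary.PropositionalEquality
  using (_≡_; _≢_; refl; sym; trans; cong; cong₂; subst; module ≡-Reasoning)
import Relation.Binary.Reasoning.Setoid as SetoidReasoning
open import Relation.Nullary using (does)
open import Tactic.RingSolver using (solve-∀)
open import Tactic.RingSolver.Core.AlmostCommutativeRing
  using (AlmostCommutativeRing; fromCommutativeRing)

-- Polynomial arithmetic

infix 4 _≋_

-- `_≈P_` is a Π-type, from which Agda cannot infer the two polynomials;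
-- the record makes them recoverable from the proof.
record _≋_ (p q : Poly) : Set where
  constructor mk≋
  field coeff-≡ : p ≈P q
open _≋_

≋-refl : ∀ {p} → p ≋ p
≋-refl = mk≋ λ _ → refl

≋-sym : ∀ {p q} → p ≋ q → q ≋ p
≋-sym (mk≋ e) = mk≋ λ i → sym (e i)

≋-trans : ∀ {p q r} → p ≋ q → q ≋ r → p ≋ r
≋-trans (mk≋ e) (mk≋ f) = mk≋ λ i → trans (e i) (f i)

≡⇒≋ : ∀ {p q} → p ≡ q → p ≋ q
≡⇒≋ refl = ≋-refl

scale : ℤ → Poly → Poly
scale a = List.map (a ℤ.*_)

shift : Poly → Poly
shift p = + 0 ∷ p

coeff-+P : ∀ p q i → coeff (p +P q) i ≡ coeff p i ℤ.+ coeff q i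
coeff-+P []      q       i       = sym (ℤ.+-identityˡ _)
coeff-+P (a ∷ p) []      i       = sym (ℤ.+-identityʳ _)
coeff-+P (a ∷ p) (b ∷ q) zero    = refl
coeff-+P (a ∷ p) (b ∷ q) (suc i) = coeff-+P p q i

coeff-negP : ∀ p i → coeff (negP p) i ≡ - coeff p i
coeff-negP []      i       = refl
coeff-negP (a ∷ p) zero    = refl
coeff-negP (a ∷ p) (suc i) = coeff-negP p i

coeff-scale : ∀ a p i → coeff (scale a p) i ≡ a ℤ.* coeff p i
coeff-scale a []      i       = sym (ℤ.*-zeroʳ a)
coeff-scale a (b ∷ p) zero    = refl
coeff-scale a (b ∷ p) (suc i) = coeff-scale a p i

coeff-drop1 : ∀ p i → coeff (List.drop 1 p) i ≡ coeff p (suc i)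
coeff-drop1 []      i = refl
coeff-drop1 (a ∷ p) i = refl

coeff-*P-zero : ∀ p q → coeff (p *P q) 0 ≡ coeff p 0 ℤ.* coeff q 0
coeff-*P-zero []      q = refl
coeff-*P-zero (a ∷ p) q = begin
  coeff (scale a q +P shift (p *P q)) 0 ≡⟨ coeff-+P (scale a q) _ 0 ⟩
  coeff (scale a q) 0 ℤ.+ + 0           ≡⟨ ℤ.+-identityʳ _ ⟩
  coeff (scale a q) 0                   ≡⟨ coeff-scale a q 0 ⟩
  a ℤ.* coeff q 0                       ∎
  where open ≡-Reasoning

coeff-*P-suc : ∀ p q i →
  coeff (p *P q) (suc i) ≡ coeff p 0 ℤ.* coeff q (suc i) ℤ.+ coeff (List.drop 1 p *P q) i
coeff-*P-suc []      q i = refl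
coeff-*P-suc (a ∷ p) q i =
  trans (coeff-+P (scale a q) (shift (p *P q)) (suc i))
        (cong (ℤ._+ coeff (p *P q) i) (coeff-scale a q (suc i)))

+P-cong : ∀ {p p′ q q′} → p ≋ p′ → q ≋ q′ → p +P q ≋ p′ +P q′
+P-cong {p} {p′} {q} {q′} (mk≋ e) (mk≋ f) = mk≋ λ i →
  trans (coeff-+P p q i) (trans (cong₂ ℤ._+_ (e i) (f i)) (sym (coeff-+P p′ q′ i)))

negP-cong : ∀ {p p′} → p ≋ p′ → negP p ≋ negP p′
negP-cong {p} {p′} (mk≋ e) = mk≋ λ i →
  trans (coeff-negP p i) (trans (cong -_ (e i)) (sym (coeff-negP p′ i)))

shift-cong : ∀ {p p′} → p ≋ p′ → shift p ≋ shift p′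
shift-cong (mk≋ e) = mk≋ λ where
  zero    → refl
  (suc i) → e i

*P-congˡ : ∀ {p p′} q → p ≈P p′ → p *P q ≈P p′ *P q
*P-congˡ {p} {p′} q e zero =
  trans (coeff-*P-zero p q) (trans (cong (ℤ._* coeff q 0) (e 0)) (sym (coeff-*P-zero p′ q)))
*P-congˡ {p} {p′} q e (suc i) =
  trans (coeff-*P-suc p q i)
    (trans (cong₂ ℤ._+_ (cong (ℤ._* coeff q (suc i)) (e 0)) (*P-congˡ {List.drop 1 p} {List.drop 1 p′} q drop1-≈ i))
           (sym (coeff-*P-suc p′ q i)))
  where
  drop1-≈ : List.drop 1 p ≈P List.drop 1 p′
  drop1-≈ j = trans (coeff-drop1 p j) (trans (e (suc j)) (sym (coeff-drop1 p′ j)))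

*P-congʳ : ∀ p {q q′} → q ≈P q′ → p *P q ≈P p *P q′
*P-congʳ p {q} {q′} e zero =
  trans (coeff-*P-zero p q) (trans (cong (coeff p 0 ℤ.*_) (e 0)) (sym (coeff-*P-zero p q′)))
*P-congʳ p {q} {q′} e (suc i) =
  trans (coeff-*P-suc p q i)
    (trans (cong₂ ℤ._+_ (cong (coeff p 0 ℤ.*_) (e (suc i))) (*P-congʳ (List.drop 1 p) {q} {q′} e i))
           (sym (coeff-*P-suc p q′ i)))

*P-cong : ∀ {p p′ q q′} → p ≋ p′ → q ≋ q′ → p *P q ≋ p′ *P q′
*P-cong {p} {p′} {q} {q′} (mk≋ e) (mk≋ f) = mk≋ λ i →
  trans (*P-congˡ {p} {p′} q e i) (*P-congʳ p′ {q} {q′} f i)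

+P-comm : ∀ p q → p +P q ≋ q +P p
+P-comm p q = mk≋ λ i →
  trans (coeff-+P p q i) (trans (ℤ.+-comm (coeff p i) _) (sym (coeff-+P q p i)))

+P-assoc : ∀ p q r → (p +P q) +P r ≋ p +P (q +P r)
+P-assoc p q r = mk≋ λ i → begin
  coeff ((p +P q) +P r) i                     ≡⟨ coeff-+P (p +P q) r i ⟩
  coeff (p +P q) i ℤ.+ coeff r i              ≡⟨ cong (ℤ._+ coeff r i) (coeff-+P p q i) ⟩
  coeff p i ℤ.+ coeff q i ℤ.+ coeff r i       ≡⟨ ℤ.+-assoc (coeff p i) _ _ ⟩
  coeff p i ℤ.+ (coeff q i ℤ.+ coeff r i)     ≡⟨ cong (ℤ._+_ (coeff p i)) (coeff-+P q r i) ⟨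
  coeff p i ℤ.+ coeff (q +P r) i              ≡⟨ coeff-+P p (q +P r) i ⟨
  coeff (p +P (q +P r)) i                     ∎
  where open ≡-Reasoning

+P-identityˡ : ∀ p → [] +P p ≋ p
+P-identityˡ p = ≋-refl

+P-identityʳ : ∀ p → p +P [] ≋ p
+P-identityʳ []      = ≋-refl
+P-identityʳ (a ∷ p) = ≋-refl

+P-inverseˡ : ∀ p → negP p +P p ≋ []
+P-inverseˡ p = mk≋ λ i →
  trans (coeff-+P (negP p) p i)
        (trans (cong (ℤ._+ coeff p i) (coeff-negP p i)) (ℤ.+-inverseˡ (coeff p i)))

+P-inverseʳ : ∀ p → p +P negP p ≋ []
+P-inverseʳ p = ≋-trans (+P-comm p (negP p)) (+P-inverseˡ p)

shift-[] : shift [] ≋ []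
shift-[] = mk≋ λ where
  zero    → refl
  (suc i) → refl

*P-zeroʳ : ∀ p → p *P [] ≋ []
*P-zeroʳ []      = ≋-refl
*P-zeroʳ (a ∷ p) = ≋-trans (shift-cong (*P-zeroʳ p)) shift-[]

*P-∷ʳ : ∀ p b q → p *P (b ∷ q) ≋ scale b p +P shift (p *P q)
*P-∷ʳ []      b q = ≋-sym shift-[]
*P-∷ʳ (a ∷ p) b q =
  ≋-trans (+P-cong (≋-refl {scale a (b ∷ q)}) (shift-cong (*P-∷ʳ p b q))) (mk≋ coeffs)
  where
  exchange : ∀ u v w → u ℤ.+ (v ℤ.+ w) ≡ v ℤ.+ (u ℤ.+ w)
  exchange = ℤ-Solver.solve-∀
  coeffs : scale a (b ∷ q) +P shift (scale b p +P shift (p *P q))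
        ≈P scale b (a ∷ p) +P shift (scale a q +P shift (p *P q))
  coeffs zero    = cong (ℤ._+ + 0) (ℤ.*-comm a b)
  coeffs (suc i) = begin
    coeff (scale a q +P (scale b p +P shift (p *P q))) i
      ≡⟨ coeff-+P (scale a q) _ i ⟩
    coeff (scale a q) i ℤ.+ coeff (scale b p +P shift (p *P q)) i
      ≡⟨ cong (ℤ._+_ (coeff (scale a q) i)) (coeff-+P (scale b p) _ i) ⟩
    coeff (scale a q) i ℤ.+ (coeff (scale b p) i ℤ.+ coeff (shift (p *P q)) i)
      ≡⟨ exchange (coeff (scale a q) i) (coeff (scale b p) i) (coeff (shift (p *P q)) i) ⟩
    coeff (scale b p) i ℤ.+ (coeff (scale a q) i ℤ.+ coeff (shift (p *P q)) i)
      ≡⟨ cong (ℤ._+_ (coeff (scale b p) i)) (coeff-+P (scale a q) _ i) ⟨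
    coeff (scale b p) i ℤ.+ coeff (scale a q +P shift (p *P q)) i
      ≡⟨ coeff-+P (scale b p) _ i ⟨
    coeff (scale b p +P (scale a q +P shift (p *P q))) i
      ∎
    where open ≡-Reasoning

*P-comm : ∀ p q → p *P q ≋ q *P p
*P-comm []      q = ≋-sym (*P-zeroʳ q)
*P-comm (a ∷ p) q =
  ≋-trans (+P-cong (≋-refl {scale a q}) (shift-cong (*P-comm p q))) (≋-sym (*P-∷ʳ q a p))

scale-distrib-+ : ∀ a b p → scale (a ℤ.+ b) p ≋ scale a p +P scale b p
scale-distrib-+ a b p = mk≋ λ i → begin
  coeff (scale (a ℤ.+ b) p) i               ≡⟨ coeff-scale (a ℤ.+ b) p i ⟩
  (a ℤ.+ b) ℤ.* coeff p i                   ≡⟨ ℤ.*-distribʳ-+ (coeff p i) a b ⟩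
  a ℤ.* coeff p i ℤ.+ b ℤ.* coeff p i       ≡⟨ cong₂ ℤ._+_ (coeff-scale a p i) (coeff-scale b p i) ⟨
  coeff (scale a p) i ℤ.+ coeff (scale b p) i ≡⟨ coeff-+P (scale a p) _ i ⟨
  coeff (scale a p +P scale b p) i          ∎
  where open ≡-Reasoning

scale-+P : ∀ a p q → scale a (p +P q) ≋ scale a p +P scale a q
scale-+P a p q = mk≋ λ i → begin
  coeff (scale a (p +P q)) i                  ≡⟨ coeff-scale a (p +P q) i ⟩
  a ℤ.* coeff (p +P q) i                      ≡⟨ cong (a ℤ.*_) (coeff-+P p q i) ⟩
  a ℤ.* (coeff p i ℤ.+ coeff q i)             ≡⟨ ℤ.*-distribˡ-+ a (coeff p i) _ ⟩
  a ℤ.* coeff p i ℤ.+ a ℤ.* coeff q i         ≡⟨ cong₂ ℤ._+_ (coeff-scale a p i) (coeff-scale a q i) ⟨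
  coeff (scale a p) i ℤ.+ coeff (scale a q) i ≡⟨ coeff-+P (scale a p) _ i ⟨
  coeff (scale a p +P scale a q) i            ∎
  where open ≡-Reasoning

*P-distribʳ : ∀ p q r → (p +P q) *P r ≋ p *P r +P q *P r
*P-distribʳ []      q       r = ≋-refl
*P-distribʳ (a ∷ p) []      r = ≋-sym (+P-identityʳ _)
*P-distribʳ (a ∷ p) (b ∷ q) r =
  ≋-trans (+P-cong (scale-distrib-+ a b r) (shift-cong (*P-distribʳ p q r)))
          (interchange (scale a r) (scale b r) (shift (p *P r)) (shift (q *P r)))
  where
  interchange : ∀ u v x y → (u +P v) +P (x +P y) ≋ (u +P x) +P (v +P y)
  interchange u v x y = mk≋ λ i → begin
    coeff ((u +P v) +P (x +P y)) i
      ≡⟨ trans (coeff-+P (u +P v) _ i) (cong₂ ℤ._+_ (coeff-+P u v i) (coeff-+P x y i)) ⟩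
    (coeff u i ℤ.+ coeff v i) ℤ.+ (coeff x i ℤ.+ coeff y i)
      ≡⟨ ℤ-interchange (coeff u i) (coeff v i) (coeff x i) (coeff y i) ⟩
    (coeff u i ℤ.+ coeff x i) ℤ.+ (coeff v i ℤ.+ coeff y i)
      ≡⟨ sym (trans (coeff-+P (u +P x) _ i) (cong₂ ℤ._+_ (coeff-+P u x i) (coeff-+P v y i))) ⟩
    coeff ((u +P x) +P (v +P y)) i
      ∎
    where
    open ≡-Reasoning
    ℤ-interchange : ∀ a b c d → (a ℤ.+ b) ℤ.+ (c ℤ.+ d) ≡ (a ℤ.+ c) ℤ.+ (b ℤ.+ d)
    ℤ-interchange = ℤ-Solver.solve-∀

*P-distribˡ : ∀ p q r → p *P (q +P r) ≋ p *P q +P p *P r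
*P-distribˡ p q r =
  ≋-trans (*P-comm p (q +P r))
    (≋-trans (*P-distribʳ q r p) (+P-cong (*P-comm q p) (*P-comm r p)))

scale-scale : ∀ a b p → scale a (scale b p) ≋ scale (a ℤ.* b) p
scale-scale a b p = mk≋ λ i →
  trans (coeff-scale a (scale b p) i)
    (trans (cong (a ℤ.*_) (coeff-scale b p i))
      (trans (sym (ℤ.*-assoc a b _)) (sym (coeff-scale (a ℤ.* b) p i))))

scale-shift : ∀ a p → scale a (shift p) ≋ shift (scale a p)
scale-shift a p = mk≋ λ where
  zero    → ℤ.*-zeroʳ a
  (suc i) → refl

scale-*P : ∀ a p q → scale a p *P q ≋ scale a (p *P q)
scale-*P a []      q = ≋-refl
scale-*P a (b ∷ p) q =
  ≋-trans (+P-cong (≋-sym (scale-scale a b q)) (≋-trans (shift-cong (scale-*P a p q))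
                                                         (≋-sym (scale-shift a (p *P q)))))
          (≋-sym (scale-+P a (scale b q) (shift (p *P q))))

shift-*P : ∀ p q → shift p *P q ≋ shift (p *P q)
shift-*P p q = +P-cong {scale (+ 0) q} {[]} (mk≋ λ i → coeff-scale (+ 0) q i) ≋-refl

*P-assoc : ∀ p q r → (p *P q) *P r ≋ p *P (q *P r)
*P-assoc []      q r = ≋-refl
*P-assoc (a ∷ p) q r =
  ≋-trans (*P-distribʳ (scale a q) (shift (p *P q)) r)
    (+P-cong (scale-*P a q r) (≋-trans (shift-*P (p *P q) r) (shift-cong (*P-assoc p q r))))

*P-identityˡ : ∀ p → constP (+ 1) *P p ≋ p
*P-identityˡ p = mk≋ λ i →
  trans (coeff-+P (scale (+ 1) p) (shift []) i)
    (trans (cong₂ ℤ._+_ (coeff-scale (+ 1) p i) (coeff-≡ shift-[] i))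
      (trans (ℤ.+-identityʳ _) (ℤ.*-identityˡ _)))

*P-identityʳ : ∀ p → p *P constP (+ 1) ≋ p
*P-identityʳ p = ≋-trans (*P-comm p _) (*P-identityˡ p)

Poly-isCommutativeRing : IsCommutativeRing _≋_ _+P_ _*P_ negP [] (constP (+ 1))
Poly-isCommutativeRing = record
  { isRing = record
    { +-isAbelianGroup = record
      { isGroup = record
        { isMonoid = record
          { isSemigroup = record
            { isMagma = record
              { isEquivalence = record { refl = ≋-refl ; sym = ≋-sym ; trans = ≋-trans }
              ; ∙-cong = +P-cong }
            ; assoc = +P-assoc }
          ; identity = +P-identityˡ , +P-identityʳ }
        ; inverse = +P-inverseˡ , +P-inverseʳ
        ; ⁻¹-cong = negP-cong }
      ; comm = +P-comm }
    ; *-cong = *P-cong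
    ; *-assoc = *P-assoc
    ; *-identity = *P-identityˡ , *P-identityʳ
    ; distrib = *P-distribˡ , λ r p q → *P-distribʳ p q r }
  ; *-comm = *P-comm }

Poly-commutativeRing : CommutativeRing _ _
Poly-commutativeRing = record { isCommutativeRing = Poly-isCommutativeRing }

Poly-ring : AlmostCommutativeRing _ _
Poly-ring = fromCommutativeRing Poly-commutativeRing ≋[]?
  where
  ≋[]? : ∀ p → Maybe ([] ≋ p)
  ≋[]? []           = just ≋-refl
  ≋[]? (+ zero ∷ p) = Maybe.map (λ (mk≋ e) → mk≋ λ { zero → refl ; (suc i) → e i }) (≋[]? p)
  ≋[]? (_ ∷ _)      = nothing

Poly-setoid : Setoid _ _
Poly-setoid = CommutativeRing.setoid Poly-commutativeRing

constP-*P : ∀ a b → constP a *P constP b ≋ constP (a ℤ.* b)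
constP-*P a b = mk≋ λ where
  zero          → ℤ.+-identityʳ _
  (suc zero)    → refl
  (suc (suc i)) → refl

constP-0 : constP (+ 0) ≋ []
constP-0 = mk≋ λ where
  zero    → refl
  (suc i) → refl

≋[]-selfNegation : ∀ {p} → p ≋ negP p → p ≋ []
≋[]-selfNegation {p} (mk≋ e) = mk≋ λ i → ≡-neg⇒0 (trans (e i) (coeff-negP p i))
  where
  ≡-neg⇒0 : ∀ {c : ℤ} → c ≡ - c → c ≡ + 0
  ≡-neg⇒0 {+ zero} _ = refl

-- Determinants

Mat : ℕ → Set
Mat n = Fin n → Fin n → Poly

sign : ℕ → ℤ
sign m = if isEven m then + 1 else - + 1

signP : ∀ {n} → Fin n → Poly
signP j = constP (sign (toℕ j))

isEven-suc : ∀ m → isEven (suc m) ≡ not (isEven m)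
isEven-suc zero          = refl
isEven-suc (suc zero)    = refl
isEven-suc (suc (suc m)) = isEven-suc m

sign-suc : ∀ m → sign (suc m) ≡ - sign m
sign-suc m rewrite isEven-suc m with isEven m
... | true  = refl
... | false = refl

sign-± : ∀ m → sign m ≡ + 1 ⊎ sign m ≡ - + 1
sign-± m with isEven m
... | true  = inj₁ refl
... | false = inj₂ refl

sign*sign : ∀ m → sign m ℤ.* sign m ≡ + 1
sign*sign m with isEven m
... | true  = refl
... | false = refl

minor₀ : ∀ {n} → Fin (suc n) → Mat (suc n) → Mat n
minor₀ j M r c = M (suc r) (punchIn j c)

laplaceTerm : ∀ {n} → Mat (suc n) → Fin (suc n) → Poly
laplaceTerm M j = signP j *P (M zero j *P det (minor₀ j M))

setRow : ∀ {n} → Mat n → Fin n → (Fin n → Poly) → Mat n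
setRow M k u = updateAt M k (const u)

sumP-cong : ∀ {n} {f g : Fin n → Poly} → (∀ j → f j ≋ g j) → sumP f ≋ sumP g
sumP-cong {zero}  eq = ≋-refl
sumP-cong {suc n} eq = +P-cong (eq zero) (sumP-cong (eq ∘ suc))

det-cong : ∀ {n} {M N : Mat n} → (∀ i j → M i j ≋ N i j) → det M ≋ det N
det-cong {zero}  eq = ≋-refl
det-cong {suc n} eq = sumP-cong λ j →
  *P-cong (≋-refl {signP j}) (*P-cong (eq zero j) (det-cong λ r c → eq (suc r) (punchIn j c)))

det-cong-≡ : ∀ {n} {M N : Mat n} → (∀ i j → M i j ≡ N i j) → det M ≋ det N
det-cong-≡ eq = det-cong λ i j → ≡⇒≋ (eq i j)

sumP-+P : ∀ {n} (f g : Fin n → Poly) → sumP (λ j → f j +P g j) ≋ sumP f +P sumP g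
sumP-+P {zero}  f g = ≋-refl
sumP-+P {suc n} f g =
  ≋-trans (+P-cong (≋-refl {f zero +P g zero}) (sumP-+P (f ∘ suc) (g ∘ suc)))
          (interchange (f zero) (g zero) (sumP (f ∘ suc)) (sumP (g ∘ suc)))
  where
  interchange : ∀ a b x y → (a +P b) +P (x +P y) ≋ (a +P x) +P (b +P y)
  interchange = solve-∀ Poly-ring

*P-sumP : ∀ {n} p (f : Fin n → Poly) → p *P sumP f ≋ sumP (λ j → p *P f j)
*P-sumP {zero}  p f = *P-zeroʳ p
*P-sumP {suc n} p f =
  ≋-trans (*P-distribˡ p (f zero) _) (+P-cong (≋-refl {p *P f zero}) (*P-sumP p (f ∘ suc)))

negP-sumP : ∀ {n} (f : Fin n → Poly) → negP (sumP f) ≋ sumP (λ j → negP (f j))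
negP-sumP {zero}  f = ≋-refl
negP-sumP {suc n} f =
  ≋-trans (negP-+P (f zero) (sumP (f ∘ suc))) (+P-cong (≋-refl {negP (f zero)}) (negP-sumP (f ∘ suc)))
  where
  negP-+P : ∀ a x → negP (a +P x) ≋ negP a +P negP x
  negP-+P = solve-∀ Poly-ring

sumP-zero : ∀ {n} (f : Fin n → Poly) → (∀ j → f j ≋ []) → sumP f ≋ []
sumP-zero {zero}  f eq = ≋-refl
sumP-zero {suc n} f eq = +P-cong (eq zero) (sumP-zero (f ∘ suc) (eq ∘ suc))

sumP-head : ∀ {n} (f : Fin (suc n) → Poly) → (∀ j → f (suc j) ≋ []) → sumP f ≋ f zero
sumP-head f eq = ≋-trans (+P-cong (≋-refl {f zero}) (sumP-zero _ eq)) (+P-identityʳ _)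

sumP-head₂ : ∀ {n} (f : Fin (suc (suc n)) → Poly) → (∀ j → f (suc (suc j)) ≋ []) →
  sumP f ≋ f zero +P f (suc zero)
sumP-head₂ f eq = +P-cong (≋-refl {f zero}) (sumP-head (f ∘ suc) eq)

sumP-last₂ : ∀ n (f : Fin (suc (suc n)) → Poly) → (∀ j → f (inject₁ (inject₁ j)) ≋ []) →
  sumP f ≋ f (inject₁ (fromℕ n)) +P f (fromℕ (suc n))
sumP-last₂ zero    f eq = +P-cong (≋-refl {f zero}) (+P-identityʳ _)
sumP-last₂ (suc n) f eq = +P-cong (eq zero) (sumP-last₂ n (f ∘ suc) (eq ∘ suc))

sumPairs : ∀ {n} → (Fin (suc n) → Fin (suc n) → Poly) → Poly
sumPairs h = sumP (λ a → sumP (λ c → h a (punchIn a c)))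

sumPairs-cong : ∀ {n} {h g : Fin (suc n) → Fin (suc n) → Poly} →
  (∀ a c → h a (punchIn a c) ≋ g a (punchIn a c)) → sumPairs h ≋ sumPairs g
sumPairs-cong eq = sumP-cong λ a → sumP-cong λ c → eq a c

negP-sumPairs : ∀ {n} (h : Fin (suc n) → Fin (suc n) → Poly) →
  negP (sumPairs h) ≋ sumPairs (λ a b → negP (h a b))
negP-sumPairs h =
  ≋-trans (negP-sumP (λ a → sumP (λ c → h a (punchIn a c))))
          (sumP-cong λ a → negP-sumP (λ c → h a (punchIn a c)))

sumPairs-flip : ∀ n (h : Fin (suc n) → Fin (suc n) → Poly) → sumPairs h ≋ sumPairs (λ a b → h b a)
sumPairs-flip zero    h = ≋-refl
sumPairs-flip (suc n) h =
  ≋-trans (+P-cong (≋-refl {top}) (sumP-+P (λ a → h (suc a) zero) (λ a → sumP (λ c → h (suc a) (suc (punchIn a c))))))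
  (≋-trans (+P-cong (≋-refl {top}) (+P-cong (≋-refl {left}) (sumPairs-flip n (λ a b → h (suc a) (suc b)))))
  (≋-trans (exchange top left (sumPairs (λ a b → h (suc b) (suc a))))
    (≋-sym (+P-cong (≋-refl {left}) (sumP-+P (λ a → h zero (suc a)) (λ a → sumP (λ c → h (suc (punchIn a c)) (suc a))))))))
  where
  top left : Poly
  top  = sumP (λ c → h zero (suc c))
  left = sumP (λ a → h (suc a) zero)
  exchange : ∀ a b t → a +P (b +P t) ≋ b +P (a +P t)
  exchange = solve-∀ Poly-ring

-- The sign of the term of the Laplace expansion along the first two rows
-- that uses columns a ≠ b.
pairSign : ∀ {k} → Fin k → Fin k → ℤ
pairSign zero    zero    = + 1
pairSign zero    (suc b) = - sign (suc (toℕ b))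
pairSign (suc a) zero    = sign (suc (toℕ a))
pairSign (suc a) (suc b) = pairSign a b

sign*sign≡pairSign : ∀ {n} (a : Fin (suc n)) (c : Fin n) →
  sign (toℕ a) ℤ.* sign (toℕ c) ≡ pairSign a (punchIn a c)
sign*sign≡pairSign zero c =
  trans (ℤ.*-identityˡ _) (sym (trans (cong -_ (sign-suc (toℕ c))) (ℤ.neg-involutive _)))
sign*sign≡pairSign (suc a) zero    = ℤ.*-identityʳ _
sign*sign≡pairSign (suc a) (suc c) =
  trans (cong₂ ℤ._*_ (sign-suc (toℕ a)) (sign-suc (toℕ c)))
    (trans (neg*neg (sign (toℕ a)) (sign (toℕ c))) (sign*sign≡pairSign a c))
  where
  neg*neg : ∀ x y → (- x) ℤ.* (- y) ≡ x ℤ.* y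
  neg*neg = ℤ-Solver.solve-∀

pairSign-antisym : ∀ {n} (a : Fin (suc n)) (c : Fin n) →
  pairSign (punchIn a c) a ≡ - pairSign a (punchIn a c)
pairSign-antisym zero    c       = sym (ℤ.neg-involutive _)
pairSign-antisym (suc a) zero    = refl
pairSign-antisym (suc a) (suc c) = pairSign-antisym a c

-- The c-th column other than a and b (meaningful for a ≠ b).
punchIn₂ : ∀ {n} → Fin (suc (suc n)) → Fin (suc (suc n)) → Fin n → Fin (suc (suc n))
punchIn₂ zero    zero    c = suc (suc c)
punchIn₂ zero    (suc b) c = suc (punchIn b c)
punchIn₂ (suc a) zero    c = suc (punchIn a c)
punchIn₂ {suc n} (suc a) (suc b) zero    = zero
punchIn₂ {suc n} (suc a) (suc b) (suc c) = suc (punchIn₂ a b c)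

punchIn₂-punchIn : ∀ {n} (a : Fin (suc (suc n))) (b : Fin (suc n)) (c : Fin n) →
  punchIn₂ a (punchIn a b) c ≡ punchIn a (punchIn b c)
punchIn₂-punchIn zero    b       c       = refl
punchIn₂-punchIn (suc a) zero    c       = refl
punchIn₂-punchIn {suc n} (suc a) (suc b) zero    = refl
punchIn₂-punchIn {suc n} (suc a) (suc b) (suc c) = cong suc (punchIn₂-punchIn a b c)

punchIn₂-comm : ∀ {n} (a b : Fin (suc (suc n))) (c : Fin n) → punchIn₂ a b c ≡ punchIn₂ b a c
punchIn₂-comm zero    zero    c = refl
punchIn₂-comm zero    (suc b) c = refl
punchIn₂-comm (suc a) zero    c = refl
punchIn₂-comm {suc n} (suc a) (suc b) zero    = refl
punchIn₂-comm {suc n} (suc a) (suc b) (suc c) = cong suc (punchIn₂-comm a b c)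

laplaceTerm₂ : ∀ {n} → Mat (suc (suc n)) → Fin (suc (suc n)) → Fin (suc (suc n)) → Poly
laplaceTerm₂ M a b =
  constP (pairSign a b) *P (M zero a *P (M (suc zero) b *P det (λ r c → M (suc (suc r)) (punchIn₂ a b c))))

det≋sumPairs : ∀ {n} (M : Mat (suc (suc n))) → det M ≋ sumPairs (laplaceTerm₂ M)
det≋sumPairs {n} M = sumP-cong λ a →
  ≋-trans (*P-cong (≋-refl {signP a}) (*P-sumP (M zero a) (inner a)))
  (≋-trans (*P-sumP (signP a) (λ c → M zero a *P inner a c))
  (sumP-cong λ c →
    ≋-trans (regroup (signP a) (signP c) (M zero a) (M (suc zero) (punchIn a c)) _)
      (*P-cong (≋-trans (constP-*P (sign (toℕ a)) (sign (toℕ c))) (≡⇒≋ (cong constP (sign*sign≡pairSign a c))))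
        (*P-cong (≋-refl {M zero a}) (*P-cong (≋-refl {M (suc zero) (punchIn a c)})
          (det-cong-≡ λ r d → cong (M (suc (suc r))) (sym (punchIn₂-punchIn a c d))))))))
  where
  inner : Fin (suc (suc n)) → Fin (suc n) → Poly
  inner a c = signP c *P (M (suc zero) (punchIn a c) *P det (λ r d → M (suc (suc r)) (punchIn a (punchIn c d))))
  regroup : ∀ x y u v d → x *P (u *P (y *P (v *P d))) ≋ (x *P y) *P (u *P (v *P d))
  regroup = solve-∀ Poly-ring

swap₀₁ : ∀ {n} → Fin (suc (suc n)) → Fin (suc (suc n))
swap₀₁ zero          = suc zero
swap₀₁ (suc zero)    = zero
swap₀₁ (suc (suc r)) = suc (suc r)

swap₀₁-involutive : ∀ {n} (i : Fin (suc (suc n))) → swap₀₁ (swap₀₁ i) ≡ i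
swap₀₁-involutive zero          = refl
swap₀₁-involutive (suc zero)    = refl
swap₀₁-involutive (suc (suc i)) = refl

-- Swapping the first two rows exchanges the roles of a and b in the
-- expansion along those rows, and pairSign is antisymmetric.
det-swap₀₁ : ∀ {n} (M : Mat (suc (suc n))) → det (M ∘ swap₀₁) ≋ negP (det M)
det-swap₀₁ {n} M = begin
  det (M ∘ swap₀₁)                                   ≈⟨ det≋sumPairs (M ∘ swap₀₁) ⟩
  sumPairs (laplaceTerm₂ (M ∘ swap₀₁))
    ≈⟨ sumPairs-cong {h = laplaceTerm₂ (M ∘ swap₀₁)} {g = λ a b → negP (laplaceTerm₂ M b a)} termwise ⟩
  sumPairs (λ a b → negP (laplaceTerm₂ M b a))       ≈⟨ negP-sumPairs (λ a b → laplaceTerm₂ M b a) ⟨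
  negP (sumPairs (λ a b → laplaceTerm₂ M b a))       ≈⟨ negP-cong (sumPairs-flip (suc n) (laplaceTerm₂ M)) ⟨
  negP (sumPairs (laplaceTerm₂ M))                   ≈⟨ negP-cong (det≋sumPairs M) ⟨
  negP (det M)                                       ∎
  where
  open SetoidReasoning Poly-setoid
  rearrange : ∀ c u v d → c *P (u *P (v *P d)) ≋ negP (negP c *P (v *P (u *P d)))
  rearrange = solve-∀ Poly-ring
  termwise : ∀ a c → laplaceTerm₂ (M ∘ swap₀₁) a (punchIn a c) ≋ negP (laplaceTerm₂ M (punchIn a c) a)
  termwise a c =
    ≋-trans (rearrange (constP (pairSign a (punchIn a c))) (M (suc zero) a) (M zero (punchIn a c)) _)
      (negP-cong (*P-cong (≡⇒≋ (cong constP (sym (pairSign-antisym a c))))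
        (*P-cong (≋-refl {M zero (punchIn a c)}) (*P-cong (≋-refl {M (suc zero) a})
          (det-cong-≡ λ r d → cong (M (suc (suc r))) (punchIn₂-comm a (punchIn a c) d))))))

sumP-linear : ∀ {n} {f : Fin n → Poly} c (g h : Fin n → Poly) →
  (∀ j → f j ≋ g j +P c *P h j) → sumP f ≋ sumP g +P c *P sumP h
sumP-linear c g h eq =
  ≋-trans (sumP-cong eq)
    (≋-trans (sumP-+P g (λ j → c *P h j)) (+P-cong (≋-refl {sumP g}) (≋-sym (*P-sumP c h))))

minor₀-setRow : ∀ {n} (M : Mat (suc (suc n))) k u j r c →
  minor₀ j (setRow M (suc k) u) r c ≡ setRow (minor₀ j M) k (u ∘ punchIn j) r c
minor₀-setRow M k u j r c =
  cong (λ row → row c)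
    (map-updateAt-local {f = _∘ punchIn j} {g = const u} {h = const (u ∘ punchIn j)} (M ∘ suc) k refl r)

det-setRow-linear : ∀ {n} (M : Mat n) k (u v : Fin n → Poly) c →
  det (setRow M k (λ j → u j +P c *P v j)) ≋ det (setRow M k u) +P c *P det (setRow M k v)
det-setRow-linear {suc n} M zero u v c =
  sumP-linear c (λ j → signP j *P (u j *P det (minor₀ j M))) (λ j → signP j *P (v j *P det (minor₀ j M))) λ j →
  distribute (signP j) (u j) (v j) c (det (minor₀ j M))
  where
  distribute : ∀ s x y c d → s *P ((x +P c *P y) *P d) ≋ s *P (x *P d) +P c *P (s *P (y *P d))
  distribute = solve-∀ Poly-ring
det-setRow-linear {suc (suc n)} M (suc k) u v c =
  ≋-trans (sumP-cong (expandMinor (λ j → u j +P c *P v j)))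
    (≋-trans (sumP-linear c (λ j → signP j *P (M zero j *P minorDet u j))
                            (λ j → signP j *P (M zero j *P minorDet v j)) λ j →
                ≋-trans (*P-cong (≋-refl {signP j}) (*P-cong (≋-refl {M zero j})
                          (det-setRow-linear (minor₀ j M) k (u ∘ punchIn j) (v ∘ punchIn j) c)))
                        (distribute (signP j) (M zero j) c (minorDet u j) (minorDet v j)))
      (≋-sym (+P-cong (sumP-cong (expandMinor u)) (*P-cong (≋-refl {c}) (sumP-cong (expandMinor v))))))
  where
  minorDet : (Fin (suc (suc n)) → Poly) → Fin (suc (suc n)) → Poly
  minorDet w j = det (setRow (minor₀ j M) k (w ∘ punchIn j))
  expandMinor : ∀ w j → laplaceTerm (setRow M (suc k) w) j ≋ signP j *P (M zero j *P minorDet w j)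
  expandMinor w j = *P-cong (≋-refl {signP j}) (*P-cong (≋-refl {M zero j})
    (det-cong-≡ (minor₀-setRow M k w j)))
  distribute : ∀ s m c d₁ d₂ → s *P (m *P (d₁ +P c *P d₂)) ≋ s *P (m *P d₁) +P c *P (s *P (m *P d₂))
  distribute = solve-∀ Poly-ring

-- Rows k and k+1 are equal: swap them to the top, where the determinant
-- changes sign under det-swap₀₁, so it equals its own negation.
det-adjacentRowsEqual : ∀ {n} (M : Mat (suc (suc n))) (k : Fin (suc n)) →
  (∀ j → M (inject₁ k) j ≋ M (suc k) j) → det M ≋ []
det-adjacentRowsEqual M zero eq =
  ≋[]-selfNegation (≋-trans (det-cong swapped) (det-swap₀₁ M))
  where
  swapped : ∀ i j → M i j ≋ M (swap₀₁ i) j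
  swapped zero          j = eq j
  swapped (suc zero)    j = ≋-sym (eq j)
  swapped (suc (suc i)) j = ≋-refl
det-adjacentRowsEqual {suc n} M (suc k) eq = sumP-zero _ λ j →
  ≋-trans (*P-cong (≋-refl {signP j}) (*P-cong (≋-refl {M zero j})
            (det-adjacentRowsEqual (minor₀ j M) k (eq ∘ punchIn j))))
          (annihilate (signP j) (M zero j))
  where
  annihilate : ∀ s m → s *P (m *P []) ≋ []
  annihilate = solve-∀ Poly-ring

det-setRow-self : ∀ {n} (M : Mat n) k → det (setRow M k (M k)) ≋ det M
det-setRow-self M k = det-cong-≡ λ i j → cong (λ row → row j) (updateAt-id-local k M refl i)

det-setRow-addMultiple : ∀ {n} (M : Mat n) (i i′ : Fin n) c → det (setRow M i (M i′)) ≋ [] →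
  det (setRow M i (λ j → M i j +P c *P M i′ j)) ≋ det M
det-setRow-addMultiple M i i′ c vanishes =
  ≋-trans (det-setRow-linear M i (M i) (M i′) c)
    (≋-trans (+P-cong (det-setRow-self M i) (*P-cong (≋-refl {c}) vanishes))
      (≋-trans (+P-cong (≋-refl {det M}) (*P-zeroʳ c)) (+P-identityʳ (det M))))

inject₁≢suc : ∀ {n} (k : Fin n) → inject₁ k ≢ suc k
inject₁≢suc zero    ()
inject₁≢suc (suc k) eq = inject₁≢suc k (suc-injective eq)

det-addMultipleOfPrevRow : ∀ {n} (M : Mat (suc (suc n))) (k : Fin (suc n)) c →
  det (setRow M (suc k) (λ j → M (suc k) j +P c *P M (inject₁ k) j)) ≋ det M
det-addMultipleOfPrevRow M k c = det-setRow-addMultiple M (suc k) (inject₁ k) c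
  (det-adjacentRowsEqual (setRow M (suc k) (M (inject₁ k))) k λ j → ≡⇒≋ (trans
    (cong (λ row → row j) (updateAt-minimal (inject₁ k) (suc k) M (inject₁≢suc k)))
    (sym (cong (λ row → row j) (updateAt-updates (suc k) M)))))

det-addMultipleOfNextRow : ∀ {n} (M : Mat (suc (suc n))) (k : Fin (suc n)) c →
  det (setRow M (inject₁ k) (λ j → M (inject₁ k) j +P c *P M (suc k) j)) ≋ det M
det-addMultipleOfNextRow M k c = det-setRow-addMultiple M (inject₁ k) (suc k) c
  (det-adjacentRowsEqual (setRow M (inject₁ k) (M (suc k))) k λ j → ≡⇒≋ (trans
    (cong (λ row → row j) (updateAt-updates (inject₁ k) M))
    (sym (cong (λ row → row j) (updateAt-minimal (suc k) (inject₁ k) M (inject₁≢suc k ∘ sym))))))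

rotate : ∀ {n} → Fin (suc n) → Fin (suc n)
rotate {n} zero = fromℕ n
rotate (suc i)  = inject₁ i

-- Rotating n+1 rows is a cyclic permutation of sign (−1)^n: swap the
-- first two rows to reduce to rotating the minors.
det-rotate : ∀ n (M : Mat (suc n)) → det (M ∘ rotate) ≋ constP (sign n) *P det M
det-rotate zero    M = ≋-sym (*P-identityˡ (det M))
det-rotate (suc n) M = begin
  det (M ∘ rotate)
    ≈⟨ det-cong-≡ (λ i j → cong (λ r → M (rotate r) j) (sym (swap₀₁-involutive i))) ⟩
  det (M ∘ rotate ∘ swap₀₁ ∘ swap₀₁)
    ≈⟨ det-swap₀₁ (M ∘ rotate ∘ swap₀₁) ⟩
  negP (det (M ∘ rotate ∘ swap₀₁))
    ≈⟨ negP-cong (sumP-cong λ j → *P-cong (≋-refl {signP j}) (*P-cong (≋-refl {M zero j})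
         (≋-trans (det-cong-≡ (minorRotated j)) (det-rotate n (minor₀ j M))))) ⟩
  negP (sumP (λ j → signP j *P (M zero j *P (constP (sign n) *P det (minor₀ j M)))))
    ≈⟨ negP-cong (sumP-cong λ j → regroup (signP j) (M zero j) (constP (sign n)) (det (minor₀ j M))) ⟩
  negP (sumP (λ j → constP (sign n) *P laplaceTerm M j))
    ≈⟨ negP-cong (*P-sumP (constP (sign n)) (laplaceTerm M)) ⟨
  negP (constP (sign n) *P det M)
    ≈⟨ negP-*P (constP (sign n)) (det M) ⟩
  constP (- sign n) *P det M
    ≡⟨ cong (λ s → constP s *P det M) (sign-suc n) ⟨
  constP (sign (suc n)) *P det M
    ∎
  where
  open SetoidReasoning Poly-setoid
  minorRotated : ∀ j r c → minor₀ j (M ∘ rotate ∘ swap₀₁) r c ≡ (minor₀ j M ∘ rotate) r c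
  minorRotated j zero    c = refl
  minorRotated j (suc r) c = refl
  regroup : ∀ s m c d → s *P (m *P (c *P d)) ≋ c *P (s *P (m *P d))
  regroup = solve-∀ Poly-ring
  negP-*P : ∀ c d → negP (c *P d) ≋ negP c *P d
  negP-*P = solve-∀ Poly-ring

det-byLastRow : ∀ n (M : Mat (suc n)) → det M ≋ constP (sign n) *P det (M ∘ rotate)
det-byLastRow n M = ≋-sym (begin
  constP (sign n) *P det (M ∘ rotate)            ≈⟨ *P-cong (≋-refl {constP (sign n)}) (det-rotate n M) ⟩
  constP (sign n) *P (constP (sign n) *P det M)  ≈⟨ *P-assoc (constP (sign n)) (constP (sign n)) (det M) ⟨
  (constP (sign n) *P constP (sign n)) *P det M  ≈⟨ *P-cong (constP-*P (sign n) (sign n)) (≋-refl {det M}) ⟩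
  constP (sign n ℤ.* sign n) *P det M            ≡⟨ cong (λ s → constP s *P det M) (sign*sign n) ⟩
  constP (+ 1) *P det M                          ≈⟨ *P-identityˡ (det M) ⟩
  det M                                          ∎)
  where open SetoidReasoning Poly-setoid

minorLast : ∀ {n} → Fin (suc n) → Mat (suc n) → Mat n
minorLast j M r c = M (inject₁ r) (punchIn j c)

penultimate : ∀ n → Fin (suc (suc n))
penultimate n = inject₁ (fromℕ n)

signP-penultimate : ∀ n → signP (penultimate n) ≡ constP (sign n)
signP-penultimate n = cong (constP ∘ sign) (trans (toℕ-inject₁ (fromℕ n)) (toℕ-fromℕ n))

signP-fromℕ : ∀ n → signP (fromℕ n) ≡ constP (sign n)
signP-fromℕ n = cong (constP ∘ sign) (toℕ-fromℕ n)

det-lastRow₂ : ∀ n (M : Mat (suc (suc n))) →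
  (∀ j → M (fromℕ (suc n)) (inject₁ (inject₁ j)) ≋ []) →
  det M ≋ M (fromℕ (suc n)) (fromℕ (suc n)) *P det (minorLast (fromℕ (suc n)) M)
       -P M (fromℕ (suc n)) (penultimate n) *P det (minorLast (penultimate n) M)
det-lastRow₂ n M vanishes = begin
  det M
    ≈⟨ det-byLastRow (suc n) M ⟩
  constP (sign (suc n)) *P sumP (laplaceTerm (M ∘ rotate))
    ≈⟨ *P-cong (≋-refl {constP (sign (suc n))}) (sumP-last₂ n (laplaceTerm (M ∘ rotate)) λ j →
         ≋-trans (*P-cong (≋-refl {signP (inject₁ (inject₁ j))}) (*P-cong (vanishes j) (≋-refl {det (minorLast _ M)})))
                 (*P-zeroʳ (signP (inject₁ (inject₁ j))))) ⟩
  constP (sign (suc n)) *P (laplaceTerm (M ∘ rotate) (penultimate n) +P laplaceTerm (M ∘ rotate) (fromℕ (suc n)))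
    ≡⟨ cong₂ (λ s t → constP (sign (suc n)) *P (s *P (u *P d₁) +P t *P (y *P d₂)))
             (signP-penultimate n) (signP-fromℕ (suc n)) ⟩
  constP (sign (suc n)) *P (constP (sign n) *P (u *P d₁) +P constP (sign (suc n)) *P (y *P d₂))
    ≈⟨ collect (sign-± n) (sign-suc n) ⟩
  y *P d₂ -P u *P d₁
    ∎
  where
  open SetoidReasoning Poly-setoid
  u = M (fromℕ (suc n)) (penultimate n)
  y = M (fromℕ (suc n)) (fromℕ (suc n))
  d₁ = det (minorLast (penultimate n) M)
  d₂ = det (minorLast (fromℕ (suc n)) M)
  collect : (sign n ≡ + 1 ⊎ sign n ≡ - + 1) → sign (suc n) ≡ - sign n →
    constP (sign (suc n)) *P (constP (sign n) *P (u *P d₁) +P constP (sign (suc n)) *P (y *P d₂))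
      ≋ y *P d₂ -P u *P d₁
  collect (inj₁ s≡1)  s′≡-s rewrite s′≡-s | s≡1  = identity u d₁ y d₂
    where
    identity : ∀ u d₁ y d₂ →
      constP (- + 1) *P (constP (+ 1) *P (u *P d₁) +P constP (- + 1) *P (y *P d₂)) ≋ y *P d₂ -P u *P d₁
    identity = solve-∀ Poly-ring
  collect (inj₂ s≡-1) s′≡-s rewrite s′≡-s | s≡-1 = identity u d₁ y d₂
    where
    identity : ∀ u d₁ y d₂ →
      constP (- - + 1) *P (constP (- + 1) *P (u *P d₁) +P constP (- - + 1) *P (y *P d₂)) ≋ y *P d₂ -P u *P d₁
    identity = solve-∀ Poly-ring

lastMinusPenultimate : ∀ {n} → Mat (suc (suc n)) → Fin (suc (suc n)) → Poly
lastMinusPenultimate {n} M j = M (fromℕ (suc n)) j -P M (penultimate n) j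

-- Subtract the penultimate row from the last, then expand along the last row.
det-lastTwoRows : ∀ n (M : Mat (suc (suc n))) →
  (∀ j → lastMinusPenultimate M (inject₁ (inject₁ j)) ≋ []) →
  det M ≋ lastMinusPenultimate M (fromℕ (suc n)) *P det (minorLast (fromℕ (suc n)) M)
       -P lastMinusPenultimate M (penultimate n) *P det (minorLast (penultimate n) M)
det-lastTwoRows n M vanishes = begin
  det M
    ≈⟨ det-addMultipleOfPrevRow M (fromℕ n) minusOne ⟨
  det M′
    ≈⟨ det-lastRow₂ n M′ (λ j → ≋-trans (newRow≋ (inject₁ (inject₁ j))) (vanishes j)) ⟩
  M′ (fromℕ (suc n)) (fromℕ (suc n)) *P det (minorLast (fromℕ (suc n)) M′)
    -P M′ (fromℕ (suc n)) (penultimate n) *P det (minorLast (penultimate n) M′)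
    ≈⟨ +P-cong (*P-cong (newRow≋ (fromℕ (suc n))) (det-cong-≡ (sameMinor (fromℕ (suc n)))))
               (negP-cong (*P-cong (newRow≋ (penultimate n)) (det-cong-≡ (sameMinor (penultimate n))))) ⟩
  lastMinusPenultimate M (fromℕ (suc n)) *P det (minorLast (fromℕ (suc n)) M)
    -P lastMinusPenultimate M (penultimate n) *P det (minorLast (penultimate n) M)
    ∎
  where
  open SetoidReasoning Poly-setoid
  minusOne : Poly
  minusOne = negP (constP (+ 1))
  newRow : Fin (suc (suc n)) → Poly
  newRow j = M (fromℕ (suc n)) j +P minusOne *P M (penultimate n) j
  M′ : Mat (suc (suc n))
  M′ = setRow M (fromℕ (suc n)) newRow
  newRow≋ : ∀ j → M′ (fromℕ (suc n)) j ≋ lastMinusPenultimate M j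
  newRow≋ j = ≋-trans (≡⇒≋ (cong (λ row → row j) (updateAt-updates (fromℕ (suc n)) M)))
                      (subtract (M (fromℕ (suc n)) j) (M (penultimate n) j))
    where
    subtract : ∀ x y → x +P negP (constP (+ 1)) *P y ≋ x -P y
    subtract = solve-∀ Poly-ring
  sameMinor : ∀ j r c → minorLast j M′ r c ≡ minorLast j M r c
  sameMinor j r c = cong (λ row → row (punchIn j c))
    (updateAt-minimal (inject₁ r) (fromℕ (suc n)) M (fromℕ≢inject₁ ∘ sym))

-- The matrix B

<⇒<ᵇ≡true : ∀ {m n} → m < n → (m ℕ.<ᵇ n) ≡ true
<⇒<ᵇ≡true {zero}  {suc n} _         = refl
<⇒<ᵇ≡true {suc m} {suc n} (s≤s m<n) = <⇒<ᵇ≡true m<n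

≥⇒<ᵇ≡false : ∀ {m n} → n ≤ m → (m ℕ.<ᵇ n) ≡ false
≥⇒<ᵇ≡false {m}     {zero}  _         = refl
≥⇒<ᵇ≡false {suc m} {suc n} (s≤s n≤m) = ≥⇒<ᵇ≡false n≤m

≤⇒≤ᵇ≡true : ∀ {m n} → m ≤ n → (m ℕ.≤ᵇ n) ≡ true
≤⇒≤ᵇ≡true {zero}  _   = refl
≤⇒≤ᵇ≡true {suc m} m<n = <⇒<ᵇ≡true m<n

>⇒≤ᵇ≡false : ∀ {m n} → n < m → (m ℕ.≤ᵇ n) ≡ false
>⇒≤ᵇ≡false {suc m} (s≤s n≤m) = ≥⇒<ᵇ≡false n≤m

≡ᵇ-refl : ∀ n → (n ℕ.≡ᵇ n) ≡ true
≡ᵇ-refl zero    = refl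
≡ᵇ-refl (suc n) = ≡ᵇ-refl n

<⇒≡ᵇ≡false : ∀ {m n} → m < n → (m ℕ.≡ᵇ n) ≡ false
<⇒≡ᵇ≡false {zero}  {suc n} _         = refl
<⇒≡ᵇ≡false {suc m} {suc n} (s≤s m<n) = <⇒≡ᵇ≡false m<n

>⇒≡ᵇ≡false : ∀ {m n} → n < m → (m ℕ.≡ᵇ n) ≡ false
>⇒≡ᵇ≡false {suc m} {zero}  _         = refl
>⇒≡ᵇ≡false {suc m} {suc n} (s≤s n<m) = >⇒≡ᵇ≡false n<m

onEven : ℕ → ℤ → ℤ
onEven P x = if isEven P then x else + 0

-- The case distinction in `Bmat` collapses to the parity of min(p, q).
Bmat-case≡onEven⊓ : ∀ (x : ℤ) P Q →
  (if isEven P then (if P ℕ.≤ᵇ Q then x else (if isEven Q then x else + 0))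
   else (if (Q ℕ.<ᵇ P) ∧ isEven Q then x else + 0))
  ≡ onEven (P ℕ.⊓ Q) x
Bmat-case≡onEven⊓ x P Q with ℕ.<-cmp P Q
... | tri< P<Q _ _ rewrite ℕ.m≤n⇒m⊓n≡m (ℕ.<⇒≤ P<Q) | ≤⇒≤ᵇ≡true (ℕ.<⇒≤ P<Q) | ≥⇒<ᵇ≡false (ℕ.<⇒≤ P<Q)
  with isEven P
...   | true  = refl
...   | false = refl
Bmat-case≡onEven⊓ x P Q | tri≈ _ refl _ rewrite ℕ.⊓-idem P | ≤⇒≤ᵇ≡true (ℕ.≤-refl {P}) | ≥⇒<ᵇ≡false (ℕ.≤-refl {P})
  with isEven P
...   | true  = refl
...   | false = refl
Bmat-case≡onEven⊓ x P Q | tri> _ _ Q<P rewrite ℕ.m≥n⇒m⊓n≡n (ℕ.<⇒≤ Q<P) | >⇒≤ᵇ≡false Q<P | <⇒<ᵇ≡true Q<P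
  with isEven P
...   | true  = refl
...   | false = refl

-- Entry (P, Q) of X·I − B, for the sequence a (0-based indices).
charEntry : (ℕ → ℕ) → ℕ → ℕ → Poly
charEntry a P Q = (if P ℕ.≡ᵇ Q then X else []) -P constP (onEven (P ℕ.⊓ Q) (+ a Q))

byIndex : ∀ {n} → (ℕ → ℕ → Poly) → Mat n
byIndex e p q = e (toℕ p) (toℕ q)

does-≟≡≡ᵇ : ∀ {n} (p q : Fin n) → does (p Fin.≟ q) ≡ (toℕ p ℕ.≡ᵇ toℕ q)
does-≟≡≡ᵇ zero    zero    = refl
does-≟≡≡ᵇ zero    (suc q) = refl
does-≟≡≡ᵇ (suc p) zero    = refl
does-≟≡≡ᵇ (suc p) (suc q) = does-≟≡≡ᵇ p q

charPoly-Bmat : ∀ {m J} (k l : Vec ℕ m) → charPoly (Bmat {J = J} k l) ≋ det (byIndex {J} (charEntry (nth (aList k l))))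
charPoly-Bmat {J = J} k l = det-cong-≡ {J} λ p q →
  cong₂ (λ δ b → δ -P constP b) (cong (if_then X else []) (does-≟≡≡ᵇ p q))
        (Bmat-case≡onEven⊓ (+ aSeq k l q) (toℕ p) (toℕ q))

punchInℕ : ℕ → ℕ → ℕ
punchInℕ J Q = if Q ℕ.<ᵇ J then Q else suc Q

punchInℕ-suc : ∀ J Q → punchInℕ (suc J) (suc Q) ≡ suc (punchInℕ J Q)
punchInℕ-suc J Q with Q ℕ.<ᵇ J
... | true  = refl
... | false = refl

toℕ-punchIn : ∀ {n} (i : Fin (suc n)) (c : Fin n) → toℕ (punchIn i c) ≡ punchInℕ (toℕ i) (toℕ c)
toℕ-punchIn zero    c       = refl
toℕ-punchIn (suc i) zero    = refl
toℕ-punchIn (suc i) (suc c) = trans (cong suc (toℕ-punchIn i c)) (sym (punchInℕ-suc (toℕ i) (toℕ c)))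

punchInℕ-< : ∀ {J Q} → Q < J → punchInℕ J Q ≡ Q
punchInℕ-< Q<J rewrite <⇒<ᵇ≡true Q<J = refl

punchInℕ-self : ∀ J → punchInℕ J J ≡ suc J
punchInℕ-self J rewrite ≥⇒<ᵇ≡false (ℕ.≤-refl {J}) = refl

minorLast-byIndex : ∀ {n} (e : ℕ → ℕ → Poly) (j : Fin (suc n)) r c →
  minorLast j (byIndex e) r c ≡ e (toℕ r) (punchInℕ (toℕ j) (toℕ c))
minorLast-byIndex e j r c = cong₂ e (toℕ-inject₁ r) (toℕ-punchIn j c)

toℕ-penultimate : ∀ n → toℕ (penultimate n) ≡ n
toℕ-penultimate n = trans (toℕ-inject₁ (fromℕ n)) (toℕ-fromℕ n)

lastMinusPenultimate-byIndex : ∀ n (e : ℕ → ℕ → Poly) j →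
  lastMinusPenultimate {n} (byIndex e) j ≡ e (suc n) (toℕ j) -P e n (toℕ j)
lastMinusPenultimate-byIndex n e j =
  cong₂ (λ P P′ → e P (toℕ j) -P e P′ (toℕ j)) (toℕ-fromℕ (suc n)) (toℕ-penultimate n)

charEntry-rowDifference-below : ∀ a J Q → Q < J → charEntry a (suc J) Q -P charEntry a J Q ≋ []
charEntry-rowDifference-below a J Q Q<J
  rewrite >⇒≡ᵇ≡false (ℕ.m<n⇒m<1+n Q<J) | >⇒≡ᵇ≡false Q<J
        | ℕ.m≥n⇒m⊓n≡n (ℕ.<⇒≤ (ℕ.m<n⇒m<1+n Q<J)) | ℕ.m≥n⇒m⊓n≡n (ℕ.<⇒≤ Q<J)
  = cancel (constP (onEven Q (+ a Q)))
  where
  cancel : ∀ c → ([] -P c) -P ([] -P c) ≋ []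
  cancel = solve-∀ Poly-ring

charEntry-rowDifference-diagonal : ∀ a J → charEntry a (suc J) J -P charEntry a J J ≋ negP X
charEntry-rowDifference-diagonal a J
  rewrite >⇒≡ᵇ≡false (ℕ.n<1+n J) | ≡ᵇ-refl J | ℕ.m≥n⇒m⊓n≡n (ℕ.n≤1+n J) | ℕ.⊓-idem J
  = cancel (constP (onEven J (+ a J))) X
  where
  cancel : ∀ c X → ([] -P c) -P (X -P c) ≋ negP X
  cancel = solve-∀ Poly-ring

onEven-suc-∸ : ∀ J x → onEven (suc J) x ℤ.- onEven J x ≡ sign (suc J) ℤ.* x
onEven-suc-∸ J x rewrite isEven-suc J with isEven J
... | true  = trans (ℤ.+-identityˡ (- x)) (sym (ℤ.-1*i≡-i x))
... | false = trans (ℤ.+-identityʳ x) (sym (ℤ.*-identityˡ x))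

charEntry-rowDifference-next : ∀ a J →
  charEntry a (suc J) (suc J) -P charEntry a J (suc J) ≋ X -P constP (sign (suc J) ℤ.* + a (suc J))
charEntry-rowDifference-next a J
  rewrite ≡ᵇ-refl J | <⇒≡ᵇ≡false (ℕ.n<1+n J) | ℕ.⊓-idem (suc J) | ℕ.m≤n⇒m⊓n≡m (ℕ.n≤1+n J)
        | sym (onEven-suc-∸ J (+ a (suc J)))
  = ≋-trans (regroup X (constP (onEven (suc J) x)) (constP (onEven J x)))
            (+P-cong (≋-refl {X}) (negP-cong (≋-sym (constP-∸ (onEven (suc J) x) (onEven J x)))))
  where
  x = + a (suc J)
  regroup : ∀ X c d → (X -P c) -P ([] -P d) ≋ X -P (c -P d)
  regroup = solve-∀ Poly-ring
  constP-∸ : ∀ c d → constP (c ℤ.- d) ≋ constP c -P constP d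
  constP-∸ c d = mk≋ λ { zero → refl ; (suc i) → refl }

charEntry-nextColumn : ∀ a J R → R ≤ J →
  charEntry a R (suc J) ≋ negP (constP (+ a (suc J))) *P constP (onEven R (+ 1))
charEntry-nextColumn a J R R≤J rewrite <⇒≡ᵇ≡false (s≤s R≤J) | ℕ.m≤n⇒m⊓n≡m (ℕ.m≤n⇒m≤1+n R≤J)
  with isEven R
... | true  = identity (constP (+ a (suc J)))
  where
  identity : ∀ c → [] -P c ≋ negP c *P constP (+ 1)
  identity = solve-∀ Poly-ring
... | false = ≋-trans (negP-cong constP-0)
                      (≋-sym (≋-trans (*P-cong (≋-refl {negP (constP (+ a (suc J)))}) constP-0) (*P-zeroʳ (negP (constP (+ a (suc J)))))))

-- Entries of the minor of X·I − B_{J+2} without its last row and penultimate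
-- column, where −a_{J+1} is generalised to an arbitrary v.
wEntry : (ℕ → ℕ) → ℕ → Poly → ℕ → ℕ → Poly
wEntry a J v P Q = if Q ℕ.<ᵇ J then charEntry a P Q else v *P constP (onEven P (+ 1))

wEntry-< : ∀ a J v P {Q} → Q < J → wEntry a J v P Q ≡ charEntry a P Q
wEntry-< a J v P Q<J rewrite <⇒<ᵇ≡true Q<J = refl

wEntry-≥ : ∀ a J v P {Q} → J ≤ Q → wEntry a J v P Q ≡ v *P constP (onEven P (+ 1))
wEntry-≥ a J v P J≤Q rewrite ≥⇒<ᵇ≡false J≤Q = refl

wEntry-rowDifference-last : ∀ a J v →
  wEntry a (suc J) v (suc J) (suc J) -P wEntry a (suc J) v J (suc J) ≋ v *P constP (sign (suc J))
wEntry-rowDifference-last a J v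
  rewrite wEntry-≥ a (suc J) v (suc J) (ℕ.≤-refl {suc J}) | wEntry-≥ a (suc J) v J (ℕ.≤-refl {suc J})
        | isEven-suc J
  with isEven J
... | true  = ≋-trans (+P-cong (≋-trans (*P-cong (≋-refl {v}) constP-0) (*P-zeroʳ v)) ≋-refl) (identity v)
  where
  identity : ∀ v → [] -P v *P constP (+ 1) ≋ v *P constP (- + 1)
  identity = solve-∀ Poly-ring
... | false = ≋-trans (+P-cong (≋-refl {v *P constP (+ 1)})
                        (negP-cong (≋-trans (*P-cong (≋-refl {v}) constP-0) (*P-zeroʳ v))))
                      (+P-identityʳ _)

-- Subtracting row J from row J+1 of a matrix given by entry formulas and
-- expanding along the last row.
det-byIndex-lastTwoRows : ∀ J (e e₁ e₂ : ℕ → ℕ → Poly) y →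
  (∀ Q → Q < J → e (suc J) Q -P e J Q ≋ []) →
  e (suc J) J -P e J J ≋ negP X →
  e (suc J) (suc J) -P e J (suc J) ≋ y →
  (∀ P Q → P < suc J → Q < suc J → e P (punchInℕ J Q) ≋ e₁ P Q) →
  (∀ P Q → P < suc J → Q < suc J → e P Q ≋ e₂ P Q) →
  det (byIndex {suc (suc J)} e) ≋ X *P det (byIndex {suc J} e₁) +P y *P det (byIndex {suc J} e₂)
det-byIndex-lastTwoRows J e e₁ e₂ y below diagonal next minor₁ minor₂ = begin
  det M
    ≈⟨ det-lastTwoRows J M (λ j →
         ≋-trans (rowDifference (inject₁ (inject₁ j)))
                 (below (toℕ (inject₁ (inject₁ j)))
                        (subst (_< J) (sym (trans (toℕ-inject₁ (inject₁ j)) (toℕ-inject₁ j))) (toℕ<n j)))) ⟩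
  lastMinusPenultimate M (fromℕ (suc J)) *P det (minorLast (fromℕ (suc J)) M)
    -P lastMinusPenultimate M (penultimate J) *P det (minorLast (penultimate J) M)
    ≈⟨ +P-cong (*P-cong lastEntry lastMinor) (negP-cong (*P-cong penultimateEntry penultimateMinor)) ⟩
  y *P d₂ -P negP X *P d₁
    ≈⟨ rearrange y d₂ X d₁ ⟩
  X *P d₁ +P y *P d₂
    ∎
  where
  open SetoidReasoning Poly-setoid
  M : Mat (suc (suc J))
  M = byIndex e
  d₁ d₂ : Poly
  d₁ = det (byIndex {suc J} e₁)
  d₂ = det (byIndex {suc J} e₂)
  rowDifference : ∀ j → lastMinusPenultimate M j ≋ e (suc J) (toℕ j) -P e J (toℕ j)
  rowDifference j = ≡⇒≋ (lastMinusPenultimate-byIndex J e j)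
  lastEntry : lastMinusPenultimate M (fromℕ (suc J)) ≋ y
  lastEntry = ≋-trans (rowDifference (fromℕ (suc J)))
                      (≋-trans (≡⇒≋ (cong (λ Q → e (suc J) Q -P e J Q) (toℕ-fromℕ (suc J)))) next)
  penultimateEntry : lastMinusPenultimate M (penultimate J) ≋ negP X
  penultimateEntry = ≋-trans (rowDifference (penultimate J))
                             (≋-trans (≡⇒≋ (cong (λ Q → e (suc J) Q -P e J Q) (toℕ-penultimate J))) diagonal)
  lastMinor : det (minorLast (fromℕ (suc J)) M) ≋ d₂
  lastMinor = det-cong λ r c → begin
    minorLast (fromℕ (suc J)) M r c            ≡⟨ minorLast-byIndex e (fromℕ (suc J)) r c ⟩
    e (toℕ r) (punchInℕ (toℕ (fromℕ (suc J))) (toℕ c))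
      ≡⟨ cong (λ K → e (toℕ r) (punchInℕ K (toℕ c))) (toℕ-fromℕ (suc J)) ⟩
    e (toℕ r) (punchInℕ (suc J) (toℕ c))       ≡⟨ cong (e (toℕ r)) (punchInℕ-< (toℕ<n c)) ⟩
    e (toℕ r) (toℕ c)                          ≈⟨ minor₂ (toℕ r) (toℕ c) (toℕ<n r) (toℕ<n c) ⟩
    e₂ (toℕ r) (toℕ c)                         ∎
  penultimateMinor : det (minorLast (penultimate J) M) ≋ d₁
  penultimateMinor = det-cong λ r c → begin
    minorLast (penultimate J) M r c            ≡⟨ minorLast-byIndex e (penultimate J) r c ⟩
    e (toℕ r) (punchInℕ (toℕ (penultimate J)) (toℕ c))
      ≡⟨ cong (λ K → e (toℕ r) (punchInℕ K (toℕ c))) (toℕ-penultimate J) ⟩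
    e (toℕ r) (punchInℕ J (toℕ c))             ≈⟨ minor₁ (toℕ r) (toℕ c) (toℕ<n r) (toℕ<n c) ⟩
    e₁ (toℕ r) (toℕ c)                         ∎
  rearrange : ∀ y d₂ X d₁ → y *P d₂ -P negP X *P d₁ ≋ X *P d₁ +P y *P d₂
  rearrange = solve-∀ Poly-ring

-- χ a J = det(X·I − B_J), and v · ω a (J+1) is the determinant of the
-- wEntry-minor.
χ ω : (ℕ → ℕ) → ℕ → Poly
χ a zero    = constP (+ 1)
χ a (suc J) = (X -P constP (sign J ℤ.* + a J)) *P χ a J -P constP (+ a J) *P (X *P ω a J)
ω a zero    = []
ω a (suc J) = X *P ω a J +P constP (sign J) *P χ a J

det-wEntry : ∀ a J v → det (byIndex {suc J} (wEntry a J v)) ≋ v *P ω a (suc J)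

det-charEntry : ∀ a J → det (byIndex {J} (charEntry a)) ≋ χ a J
det-charEntry a zero          = ≋-refl
det-charEntry a (suc zero)    rewrite ℤ.*-identityˡ (+ a 0) = identity X (constP (+ a 0))
  where
  identity : ∀ X c → constP (+ 1) *P ((X -P c) *P constP (+ 1)) +P [] ≋ (X -P c) *P constP (+ 1) -P c *P (X *P [])
  identity = solve-∀ Poly-ring
det-charEntry a (suc (suc J)) =
  ≋-trans (det-byIndex-lastTwoRows J (charEntry a) (wEntry a J v) (charEntry a) y
            (charEntry-rowDifference-below a J) (charEntry-rowDifference-diagonal a J)
            (charEntry-rowDifference-next a J) nextColumnMinor (λ _ _ _ _ → ≋-refl))
    (≋-trans (+P-cong (*P-cong (≋-refl {X}) (det-wEntry a J v)) (*P-cong (≋-refl {y}) (det-charEntry a (suc J))))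
             (recurrence X (constP (+ a (suc J))) (constP (sign (suc J) ℤ.* + a (suc J))) (ω a (suc J)) (χ a (suc J))))
  where
  v = negP (constP (+ a (suc J)))
  y = X -P constP (sign (suc J) ℤ.* + a (suc J))
  nextColumnMinor : ∀ P Q → P < suc J → Q < suc J → charEntry a P (punchInℕ J Q) ≋ wEntry a J v P Q
  nextColumnMinor P Q P≤J Q≤J with ℕ.m<1+n⇒m<n∨m≡n Q≤J
  ... | inj₁ Q<J  rewrite punchInℕ-< Q<J | wEntry-< a J v P Q<J = ≋-refl
  ... | inj₂ refl rewrite punchInℕ-self J | wEntry-≥ a J v P (ℕ.≤-refl {J}) =
    charEntry-nextColumn a J P (ℕ.s≤s⁻¹ P≤J)
  recurrence : ∀ X c sc w h → X *P (negP c *P w) +P (X -P sc) *P h ≋ (X -P sc) *P h -P c *P (X *P w)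
  recurrence = solve-∀ Poly-ring

det-wEntry a zero    v = identity v X
  where
  identity : ∀ v X → constP (+ 1) *P ((v *P constP (+ 1)) *P constP (+ 1)) +P []
                       ≋ v *P (X *P [] +P constP (+ 1) *P constP (+ 1))
  identity = solve-∀ Poly-ring
det-wEntry a (suc J) v =
  ≋-trans (det-byIndex-lastTwoRows J (wEntry a (suc J) v) (wEntry a J v) (charEntry a) (v *P constP (sign (suc J)))
            below diagonal (wEntry-rowDifference-last a J v) sameLastColumn
            (λ P Q _ Q≤J → ≡⇒≋ (wEntry-< a (suc J) v P Q≤J)))
    (≋-trans (+P-cong (*P-cong (≋-refl {X}) (det-wEntry a J v)) (*P-cong (≋-refl {v *P constP (sign (suc J))}) (det-charEntry a (suc J))))
             (recurrence X v (ω a (suc J)) (constP (sign (suc J))) (χ a (suc J))))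
  where
  below : ∀ Q → Q < J → wEntry a (suc J) v (suc J) Q -P wEntry a (suc J) v J Q ≋ []
  below Q Q<J rewrite wEntry-< a (suc J) v (suc J) (ℕ.m<n⇒m<1+n Q<J) | wEntry-< a (suc J) v J (ℕ.m<n⇒m<1+n Q<J) =
    charEntry-rowDifference-below a J Q Q<J
  diagonal : wEntry a (suc J) v (suc J) J -P wEntry a (suc J) v J J ≋ negP X
  diagonal rewrite wEntry-< a (suc J) v (suc J) (ℕ.n<1+n J) | wEntry-< a (suc J) v J (ℕ.n<1+n J) =
    charEntry-rowDifference-diagonal a J
  sameLastColumn : ∀ P Q → P < suc J → Q < suc J → wEntry a (suc J) v P (punchInℕ J Q) ≋ wEntry a J v P Q
  sameLastColumn P Q _ Q≤J with ℕ.m<1+n⇒m<n∨m≡n Q≤J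
  ... | inj₁ Q<J  rewrite punchInℕ-< Q<J | wEntry-< a (suc J) v P (ℕ.m<n⇒m<1+n Q<J) | wEntry-< a J v P Q<J = ≋-refl
  ... | inj₂ refl rewrite punchInℕ-self J | wEntry-≥ a (suc J) v P (ℕ.≤-refl {suc J}) | wEntry-≥ a J v P (ℕ.≤-refl {J}) = ≋-refl
  recurrence : ∀ X v w s h → X *P (v *P w) +P (v *P s) *P h ≋ v *P (X *P w +P s *P h)
  recurrence = solve-∀ Poly-ring

-- The threshold graph

χA : List Bool → Poly
χA s = charPoly (adjTilde s)

ΔA : List Bool → Poly
ΔA s = χA s -P X *P χA (List.drop 1 s)

charMatA : (s : List Bool) → Mat (length s)
charMatA s i j = (if does (i Fin.≟ j) then X else []) -P constP (adjTilde s i j)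

bitP : Bool → Poly
bitP b = constP (boolℤ b)

maxFin-suc : ∀ {n} (i j : Fin n) → maxFin (suc i) (suc j) ≡ suc (maxFin i j)
maxFin-suc i j with toℕ i ℕ.≤ᵇ toℕ j | ≤ᵇ-suc (toℕ i) (toℕ j)
  where
  ≤ᵇ-suc : ∀ m n → (suc m ℕ.≤ᵇ suc n) ≡ (m ℕ.≤ᵇ n)
  ≤ᵇ-suc zero    n = refl
  ≤ᵇ-suc (suc m) n = refl
... | true  | eq rewrite eq = refl
... | false | eq rewrite eq = refl

charMatA-suc : ∀ b s i j → charMatA (b ∷ s) (suc i) (suc j) ≡ charMatA s i j
charMatA-suc b s i j rewrite maxFin-suc i j = refl

χA-∷ : ∀ b s → χA (b ∷ s) ≋ X *P χA s +P ΔA (b ∷ s)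
χA-∷ b s = identity (χA (b ∷ s)) X (χA s)
  where
  identity : ∀ d X e → d ≋ X *P e +P (d -P X *P e)
  identity = solve-∀ Poly-ring

ΔA-[_] : ∀ b → ΔA (b ∷ []) ≋ negP (bitP b)
ΔA-[ b ] = identity X (bitP b)
  where
  identity : ∀ X c → (constP (+ 1) *P ((X -P c) *P constP (+ 1)) +P []) -P X *P constP (+ 1) ≋ negP c
  identity = solve-∀ Poly-ring

-- Deleting row 0 and column 1 of X·I − Ã(b c t) leaves X·I − Ã(c t) with its
-- corner entry X − c replaced by −c.
det-minor₀₁-charMatA : ∀ b c t → det (minor₀ (suc zero) (charMatA (b ∷ c ∷ t))) ≋ ΔA (c ∷ t)
det-minor₀₁-charMatA b c t = begin
  det (minor₀ (suc zero) (charMatA (b ∷ c ∷ t)))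
    ≈⟨ det-cong minor≋ ⟩
  det (setRow N zero (λ j → N zero j +P minusOne *P cornerX j))
    ≈⟨ det-setRow-linear N zero (N zero) cornerX minusOne ⟩
  det (setRow N zero (N zero)) +P minusOne *P det (setRow N zero cornerX)
    ≈⟨ +P-cong (det-setRow-self N zero) (*P-cong (≋-refl {minusOne}) (sumP-head (laplaceTerm (setRow N zero cornerX)) λ j → *P-zeroʳ (signP (suc j)))) ⟩
  χA (c ∷ t) +P minusOne *P (constP (+ 1) *P (X *P det (minor₀ zero N)))
    ≈⟨ +P-cong (≋-refl {χA (c ∷ t)}) (*P-cong (≋-refl {minusOne}) (*P-cong (≋-refl {constP (+ 1)})
         (*P-cong (≋-refl {X}) (det-cong-≡ (charMatA-suc c t))))) ⟩
  χA (c ∷ t) +P minusOne *P (constP (+ 1) *P (X *P χA t))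
    ≈⟨ identity (χA (c ∷ t)) X (χA t) ⟩
  ΔA (c ∷ t)
    ∎
  where
  open SetoidReasoning Poly-setoid
  N = charMatA (c ∷ t)
  minusOne = negP (constP (+ 1))
  cornerX : Fin (suc (length t)) → Poly
  cornerX j = if does (zero Fin.≟ j) then X else []
  minor≋ : ∀ r j → minor₀ (suc zero) (charMatA (b ∷ c ∷ t)) r j ≋ setRow N zero (λ j → N zero j +P minusOne *P cornerX j) r j
  minor≋ zero    zero    = remove (bitP c) X
    where
    remove : ∀ c X → [] -P c ≋ (X -P c) +P negP (constP (+ 1)) *P X
    remove = solve-∀ Poly-ring
  minor≋ zero    (suc j) = ≋-sym (≋-trans (+P-cong (≋-refl {N zero (suc j)}) (*P-zeroʳ minusOne)) (+P-identityʳ _))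
  minor≋ (suc r) zero    = ≋-refl
  minor≋ (suc r) (suc j) = ≡⇒≋ (charMatA-suc b (c ∷ t) (suc r) (suc j))
  identity : ∀ d X e → d +P negP (constP (+ 1)) *P (constP (+ 1) *P (X *P e)) ≋ d -P X *P e
  identity = solve-∀ Poly-ring

-- Subtract row 1 from row 0; the new row 0 is (X − b + c, −X, 0, …, 0).
χA-∷∷ : ∀ b c t → χA (b ∷ c ∷ t) ≋ (X -P bitP b +P bitP c) *P χA (c ∷ t) +P X *P ΔA (c ∷ t)
χA-∷∷ b c t = begin
  det M
    ≈⟨ det-addMultipleOfNextRow M zero minusOne ⟨
  sumP (laplaceTerm M′)
    ≈⟨ sumP-head₂ (laplaceTerm M′) (λ j →
         ≋-trans (*P-cong (≋-refl {signP (suc (suc j))}) (*P-cong (cancel (bitP (List.lookup t j))) (≋-refl {det (minor₀ (suc (suc j)) M′)})))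
                 (*P-zeroʳ (signP (suc (suc j))))) ⟩
  laplaceTerm M′ zero +P laplaceTerm M′ (suc zero)
    ≈⟨ +P-cong (*P-cong (≋-refl {constP (+ 1)}) (*P-cong (≋-refl {newRow zero}) (det-cong-≡ (charMatA-suc b (c ∷ t)))))
               (*P-cong (≋-refl {constP (- + 1)}) (*P-cong (≋-refl {newRow (suc zero)}) (det-minor₀₁-charMatA b c t))) ⟩
  constP (+ 1) *P (newRow zero *P χA (c ∷ t)) +P constP (- + 1) *P (newRow (suc zero) *P ΔA (c ∷ t))
    ≈⟨ collect X (bitP b) (bitP c) (χA (c ∷ t)) (ΔA (c ∷ t)) ⟩
  (X -P bitP b +P bitP c) *P χA (c ∷ t) +P X *P ΔA (c ∷ t)
    ∎
  where
  open SetoidReasoning Poly-setoid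
  M = charMatA (b ∷ c ∷ t)
  minusOne = negP (constP (+ 1))
  newRow : Fin (suc (suc (length t))) → Poly
  newRow j = M zero j +P minusOne *P M (suc zero) j
  M′ = setRow M zero newRow
  cancel : ∀ c → ([] -P c) +P negP (constP (+ 1)) *P ([] -P c) ≋ []
  cancel = solve-∀ Poly-ring
  collect : ∀ X B C d e →
    constP (+ 1) *P (((X -P B) +P negP (constP (+ 1)) *P ([] -P C)) *P d)
      +P constP (- + 1) *P ((([] -P C) +P negP (constP (+ 1)) *P (X -P C)) *P e)
    ≋ (X -P B +P C) *P d +P X *P e
  collect = solve-∀ Poly-ring

ΔA-∷∷ : ∀ b c t → ΔA (b ∷ c ∷ t) ≋ (bitP c -P bitP b) *P χA (c ∷ t) +P X *P ΔA (c ∷ t)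
ΔA-∷∷ b c t = ≋-trans (+P-cong (χA-∷∷ b c t) (≋-refl {negP (X *P χA (c ∷ t))}))
                      (identity X (bitP b) (bitP c) (χA (c ∷ t)) (ΔA (c ∷ t)))
  where
  identity : ∀ X B C d e → ((X -P B +P C) *P d +P X *P e) -P X *P d ≋ (C -P B) *P d +P X *P e
  identity = solve-∀ Poly-ring

-- Matching runs of the creation sequence with terms of a

Xpow-+ : ∀ m n → Xpow (m ℕ.+ n) ≋ Xpow m *P Xpow n
Xpow-+ zero    n = ≋-sym (*P-identityˡ (Xpow n))
Xpow-+ (suc m) n = ≋-trans (*P-cong (≋-refl {X}) (Xpow-+ m n)) (≋-sym (*P-assoc X (Xpow m) (Xpow n)))

Xpow-cong : ∀ {m n} → m ≡ n → Xpow m ≋ Xpow n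
Xpow-cong refl = ≋-refl

length-replicate-++ : ∀ n (b : Bool) t → length (replicate n b ++ t) ≡ n ℕ.+ length t
length-replicate-++ n b t = trans (List.length-++ (replicate n b)) (cong (ℕ._+ length t) (List.length-replicate n))

ΔA-run : ∀ b t r → ΔA (replicate (suc r) b ++ t) ≋ Xpow r *P ΔA (b ∷ t)
ΔA-run b t zero    = ≋-sym (*P-identityˡ _)
ΔA-run b t (suc r) =
  ≋-trans (ΔA-∷∷ b b (replicate r b ++ t))
    (≋-trans (dropFirst (bitP b) (χA (replicate (suc r) b ++ t)) X (ΔA (replicate (suc r) b ++ t)))
      (≋-trans (*P-cong (≋-refl {X}) (ΔA-run b t r)) (≋-sym (*P-assoc X (Xpow r) (ΔA (b ∷ t))))))
  where
  dropFirst : ∀ B d X e → (B -P B) *P d +P X *P e ≋ X *P e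
  dropFirst = solve-∀ Poly-ring

constP-suc : ∀ n → constP (+ suc n) ≋ constP (+ n) +P constP (+ 1)
constP-suc n = mk≋ λ where
  zero    → cong +_ (ℕ.+-comm 1 n)
  (suc i) → refl

χA-run : ∀ b t r → χA (replicate (suc r) b ++ t) ≋ Xpow r *P (X *P χA t +P constP (+ suc r) *P ΔA (b ∷ t))
χA-run b t zero    = ≋-trans (χA-∷ b t) (identity X (χA t) (ΔA (b ∷ t)))
  where
  identity : ∀ X e d → X *P e +P d ≋ constP (+ 1) *P (X *P e +P constP (+ 1) *P d)
  identity = solve-∀ Poly-ring
χA-run b t (suc r) = begin
  χA (b ∷ replicate (suc r) b ++ t)
    ≈⟨ χA-∷ b (replicate (suc r) b ++ t) ⟩
  X *P χA (replicate (suc r) b ++ t) +P ΔA (replicate (suc (suc r)) b ++ t)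
    ≈⟨ +P-cong (*P-cong (≋-refl {X}) (χA-run b t r)) (ΔA-run b t (suc r)) ⟩
  X *P (Xpow r *P (X *P χA t +P constP (+ suc r) *P ΔA (b ∷ t))) +P Xpow (suc r) *P ΔA (b ∷ t)
    ≈⟨ collect X (Xpow r) (χA t) (constP (+ suc r)) (ΔA (b ∷ t)) ⟩
  Xpow (suc r) *P (X *P χA t +P (constP (+ suc r) +P constP (+ 1)) *P ΔA (b ∷ t))
    ≈⟨ *P-cong (≋-refl {Xpow (suc r)}) (+P-cong (≋-refl {X *P χA t}) (*P-cong (≋-sym (constP-suc (suc r))) (≋-refl {ΔA (b ∷ t)}))) ⟩
  Xpow (suc r) *P (X *P χA t +P constP (+ suc (suc r)) *P ΔA (b ∷ t))
    ∎
  where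
  open SetoidReasoning Poly-setoid
  collect : ∀ X x e c d → X *P (x *P (X *P e +P c *P d)) +P (X *P x) *P d ≋ (X *P x) *P (X *P e +P (c +P constP (+ 1)) *P d)
  collect = solve-∀ Poly-ring

-- The suffix s of the creation sequence has been matched against the first
-- J terms of a.
record Factorisation (a : ℕ → ℕ) (s : List Bool) (J : ℕ) : Set where
  field
    J≤length : J ≤ length s
    positive : ∀ j → j < J → 1 ≤ a j
    χA≋ : χA s ≋ Xpow (length s ∸ J) *P χ a J
    ΔA≋ : ΔA s ≋ negP (Xpow (length s ∸ J) *P ω a J)
open Factorisation

bitP-not-∸ : ∀ J b → isEven J ≡ b → bitP (not b) -P bitP b ≋ negP (constP (sign J))
bitP-not-∸ J true  J-even rewrite J-even = mk≋ λ { zero → refl ; (suc i) → refl }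
bitP-not-∸ J false J-odd  rewrite J-odd  = mk≋ λ { zero → refl ; (suc i) → refl }

χ-suc≋ : ∀ a J → χ a (suc J) ≋ X *P χ a J -P constP (+ a J) *P ω a (suc J)
χ-suc≋ a J =
  ≋-trans (+P-cong (*P-cong (+P-cong (≋-refl {X}) (negP-cong (≋-sym (constP-*P (sign J) (+ a J))))) (≋-refl {χ a J}))
                   (≋-refl {negP (constP (+ a J) *P (X *P ω a J))}))
          (identity X (constP (sign J)) (constP (+ a J)) (χ a J) (ω a J))
  where
  identity : ∀ X s c h w → (X -P s *P c) *P h -P c *P (X *P w) ≋ X *P h -P c *P (X *P w +P s *P h)
  identity = solve-∀ Poly-ring

ΔA-oppositeBit : ∀ {a t′ J} b → Factorisation a (not b ∷ t′) J → isEven J ≡ b →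
  ΔA (b ∷ not b ∷ t′) ≋ negP (Xpow (length (not b ∷ t′) ∸ J) *P ω a (suc J))
ΔA-oppositeBit {a} {t′} {J} b F parity = begin
  ΔA (b ∷ not b ∷ t′)
    ≈⟨ ΔA-∷∷ b (not b) t′ ⟩
  (bitP (not b) -P bitP b) *P χA (not b ∷ t′) +P X *P ΔA (not b ∷ t′)
    ≈⟨ +P-cong (*P-cong (bitP-not-∸ J b parity) (χA≋ F)) (*P-cong (≋-refl {X}) (ΔA≋ F)) ⟩
  negP (constP (sign J)) *P (x *P χ a J) +P X *P negP (x *P ω a J)
    ≈⟨ collect x X (constP (sign J)) (χ a J) (ω a J) ⟩
  negP (x *P ω a (suc J))
    ∎
  where
  open SetoidReasoning Poly-setoid
  x = Xpow (length (not b ∷ t′) ∸ J)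
  collect : ∀ x X s h w → negP s *P (x *P h) +P X *P negP (x *P w) ≋ negP (x *P (X *P w +P s *P h))
  collect = solve-∀ Poly-ring

Xpow-run : ∀ r b t J → J ≤ length t →
  Xpow (length (replicate (suc r) b ++ t) ∸ suc J) ≋ Xpow r *P Xpow (length t ∸ J)
Xpow-run r b t J J≤t =
  ≋-trans (Xpow-cong (trans (cong (_∸ suc J) (length-replicate-++ (suc r) b t)) (ℕ.+-∸-assoc r J≤t)))
          (Xpow-+ r (length t ∸ J))

Factorisation-run : ∀ a b t′ J r → Factorisation a (not b ∷ t′) J → a J ≡ suc r → isEven J ≡ b →
  Factorisation a (replicate (suc r) b ++ not b ∷ t′) (suc J)
Factorisation-run a b t′ J r F aJ≡ parity = record
  { J≤length = subst (suc J ≤_) (sym (length-replicate-++ (suc r) b t))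
                     (s≤s (ℕ.≤-trans (J≤length F) (ℕ.m≤n+m (length t) r)))
  ; positive = λ where
      j j≤J → case ℕ.m<1+n⇒m<n∨m≡n j≤J of λ where
        (inj₁ j<J)  → positive F j j<J
        (inj₂ refl) → subst (1 ≤_) (sym aJ≡) (s≤s z≤n)
  ; χA≋ = begin
      χA (replicate (suc r) b ++ t)
        ≈⟨ χA-run b t r ⟩
      Xpow r *P (X *P χA t +P constP (+ suc r) *P ΔA (b ∷ t))
        ≈⟨ *P-cong (≋-refl {Xpow r}) (+P-cong (*P-cong (≋-refl {X}) (χA≋ F))
                                              (*P-cong (≋-refl {constP (+ suc r)}) (ΔA-oppositeBit b F parity))) ⟩
      Xpow r *P (X *P (x *P χ a J) +P constP (+ suc r) *P negP (x *P ω a (suc J)))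
        ≈⟨ collect (Xpow r) x X (constP (+ suc r)) (χ a J) (ω a (suc J)) ⟩
      (Xpow r *P x) *P (X *P χ a J -P constP (+ suc r) *P ω a (suc J))
        ≡⟨ cong (λ n → (Xpow r *P x) *P (X *P χ a J -P constP (+ n) *P ω a (suc J))) (sym aJ≡) ⟩
      (Xpow r *P x) *P (X *P χ a J -P constP (+ a J) *P ω a (suc J))
        ≈⟨ *P-cong (≋-sym (Xpow-run r b t J (J≤length F))) (≋-sym (χ-suc≋ a J)) ⟩
      Xpow (length (replicate (suc r) b ++ t) ∸ suc J) *P χ a (suc J)
        ∎
  ; ΔA≋ = begin
      ΔA (replicate (suc r) b ++ t)
        ≈⟨ ΔA-run b t r ⟩
      Xpow r *P ΔA (b ∷ t)
        ≈⟨ *P-cong (≋-refl {Xpow r}) (ΔA-oppositeBit b F parity) ⟩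
      Xpow r *P negP (x *P ω a (suc J))
        ≈⟨ pullOut (Xpow r) x (ω a (suc J)) ⟩
      negP ((Xpow r *P x) *P ω a (suc J))
        ≈⟨ negP-cong (*P-cong (≋-sym (Xpow-run r b t J (J≤length F))) (≋-refl {ω a (suc J)})) ⟩
      negP (Xpow (length (replicate (suc r) b ++ t) ∸ suc J) *P ω a (suc J))
        ∎
  }
  where
  open SetoidReasoning Poly-setoid
  t = not b ∷ t′
  x = Xpow (length t ∸ J)
  collect : ∀ y x X c h w → y *P (X *P (x *P h) +P c *P negP (x *P w)) ≋ (y *P x) *P (X *P h -P c *P w)
  collect = solve-∀ Poly-ring
  pullOut : ∀ y x w → y *P negP (x *P w) ≋ negP ((y *P x) *P w)
  pullOut = solve-∀ Poly-ring

Factorisation-zeros : ∀ a l → Factorisation a (replicate (suc l) false ++ []) 0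
Factorisation-zeros a l = record
  { J≤length = z≤n
  ; positive = λ _ ()
  ; χA≋ = ≋-trans (χA-run false [] l)
            (≋-trans (*P-cong (≋-refl {Xpow l}) (+P-cong (≋-refl {X *P constP (+ 1)}) (*P-cong (≋-refl {constP (+ suc l)}) ΔA-[0]≋[])))
              (≋-trans (identity (Xpow l) X (constP (+ suc l))) (*P-cong (≋-sym exponent) (≋-refl {constP (+ 1)}))))
  ; ΔA≋ = ≋-trans (ΔA-run false [] l)
            (≋-trans (*P-cong (≋-refl {Xpow l}) ΔA-[0]≋[]) (vanish (Xpow l) (Xpow (length (replicate (suc l) false ++ []) ∸ 0))))
  }
  where
  ΔA-[0]≋[] : ΔA (false ∷ []) ≋ []
  ΔA-[0]≋[] = ≋-trans ΔA-[ false ] (negP-cong constP-0)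
  exponent : Xpow (length (replicate (suc l) false ++ []) ∸ 0) ≋ X *P Xpow l
  exponent = Xpow-cong (trans (length-replicate-++ (suc l) false []) (ℕ.+-identityʳ (suc l)))
  identity : ∀ y X c → y *P (X *P constP (+ 1) +P c *P []) ≋ (X *P y) *P constP (+ 1)
  identity = solve-∀ Poly-ring
  vanish : ∀ y z → y *P [] ≋ negP (z *P [])
  vanish = solve-∀ Poly-ring

Factorisation-ones : ∀ a k → a 0 ≡ suc k → Factorisation a (replicate (suc k) true ++ []) 1
Factorisation-ones a k a0≡ = record
  { J≤length = s≤s z≤n
  ; positive = λ { zero _ → subst (1 ≤_) (sym a0≡) (s≤s z≤n) ; (suc j) (s≤s ()) }
  ; χA≋ = ≋-trans (χA-run true [] k)
            (≋-trans (*P-cong (≋-refl {Xpow k}) (+P-cong (≋-refl {X *P constP (+ 1)}) (*P-cong (≋-refl {constP (+ suc k)}) ΔA-[ true ])))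
              (≋-trans (identity (Xpow k) X (constP (+ suc k)))
                (*P-cong (≋-sym exponent) (≡⇒≋ (cong₂ (λ c d → (X -P constP c) *P constP (+ 1) -P constP d *P (X *P []))
                                                      (trans (cong +_ (sym a0≡)) (sym (ℤ.*-identityˡ (+ a 0))))
                                                      (cong +_ (sym a0≡)))))))
  ; ΔA≋ = ≋-trans (ΔA-run true [] k)
            (≋-trans (*P-cong (≋-refl {Xpow k}) ΔA-[ true ])
              (≋-trans (pullOut (Xpow k) X) (negP-cong (*P-cong (≋-sym exponent) (≋-refl {ω a 1})))))
  }
  where
  exponent : Xpow (length (replicate (suc k) true ++ []) ∸ 1) ≋ Xpow k
  exponent = Xpow-cong (trans (length-replicate-++ k true []) (ℕ.+-identityʳ k))
  identity : ∀ y X c → y *P (X *P constP (+ 1) +P c *P negP (constP (+ 1)))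
                        ≋ y *P ((X -P c) *P constP (+ 1) -P c *P (X *P []))
  identity = solve-∀ Poly-ring
  pullOut : ∀ y X → y *P negP (constP (+ 1)) ≋ negP (y *P (X *P [] +P constP (+ 1) *P constP (+ 1)))
  pullOut = solve-∀ Poly-ring

coeff₀-χ-suc : ∀ a J → coeff (χ a (suc J)) 0 ≡ - (sign J ℤ.* + a J) ℤ.* coeff (χ a J) 0
coeff₀-χ-suc a J = begin
  coeff (χ a (suc J)) 0
    ≡⟨ coeff-+P ((X -P c) *P χ a J) _ 0 ⟩
  coeff ((X -P c) *P χ a J) 0 ℤ.+ coeff (negP (d *P (X *P ω a J))) 0
    ≡⟨ cong₂ ℤ._+_ (coeff-*P-zero (X -P c) (χ a J))
                   (trans (coeff-negP (d *P (X *P ω a J)) 0)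
                          (cong -_ (trans (coeff-*P-zero d (X *P ω a J)) (cong (+ a J ℤ.*_) (coeff-*P-zero X (ω a J)))))) ⟩
  (+ 0 ℤ.+ - (sign J ℤ.* + a J)) ℤ.* coeff (χ a J) 0 ℤ.+ - (+ a J ℤ.* (+ 0 ℤ.* coeff (ω a J) 0))
    ≡⟨ simplify (sign J ℤ.* + a J) (coeff (χ a J) 0) (+ a J) (coeff (ω a J) 0) ⟩
  - (sign J ℤ.* + a J) ℤ.* coeff (χ a J) 0
    ∎
  where
  open ≡-Reasoning
  c = constP (sign J ℤ.* + a J)
  d = constP (+ a J)
  simplify : ∀ s h x w → (+ 0 ℤ.+ - s) ℤ.* h ℤ.+ - (x ℤ.* (+ 0 ℤ.* w)) ≡ - s ℤ.* h
  simplify = ℤ-Solver.solve-∀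

sign≢0 : ∀ m → sign m ≢ + 0
sign≢0 m with isEven m
... | true  = λ ()
... | false = λ ()

coeff₀-χ≢0 : ∀ a J → (∀ j → j < J → 1 ≤ a j) → coeff (χ a J) 0 ≢ + 0
coeff₀-χ≢0 a zero    _        ()
coeff₀-χ≢0 a (suc J) positive eq
  with ℤ.i*j≡0⇒i≡0∨j≡0 (- (sign J ℤ.* + a J)) (trans (sym (coeff₀-χ-suc a J)) eq)
... | inj₂ h≡0 = coeff₀-χ≢0 a J (λ j j<J → positive j (ℕ.m<n⇒m<1+n j<J)) h≡0
... | inj₁ -sa≡0 with ℤ.i*j≡0⇒i≡0∨j≡0 (sign J) (ℤ.neg-injective -sa≡0)
...   | inj₁ s≡0 = sign≢0 J s≡0
...   | inj₂ a≡0 = ℕ.<-irrefl (sym (ℤ.+-injective a≡0)) (positive J (ℕ.n<1+n J))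

aList-∷ : ∀ {m} x y (k l : Vec ℕ (suc m)) → aList (x ∷ k) (y ∷ l) ≡ aList k l ++ y ∷ x ∷ []
aList-∷ x y k l
  rewrite VecP.reverse-∷ (x , y) (Vec.zip k l) | VecP.toList-∷ʳ (x , y) (Vec.reverse (Vec.zip k l))
  with Vec.reverse (Vec.zip k l)
... | (x′ , _) ∷ v = cong (x′ ∷_) (List.concatMap-++ _ (Vec.toList v) _)

2*suc : ∀ m → 2 ℕ.* suc m ≡ suc (suc (2 ℕ.* m))
2*suc m = ℕ.*-suc 2 m

aList-length : ∀ m (k l : Vec ℕ (suc m)) → length (aList k l) ≡ suc (2 ℕ.* m)
aList-length zero    (x ∷ []) (y ∷ []) = refl
aList-length (suc m) (x ∷ k)  (y ∷ l)  rewrite aList-∷ x y k l =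
  trans (List.length-++ (aList k l))
        (trans (cong (ℕ._+ 2) (aList-length m k l)) (trans (ℕ.+-comm (suc (2 ℕ.* m)) 2) (cong suc (sym (2*suc m)))))

nth-++ˡ : ∀ xs ys j → j < length xs → nth (xs ++ ys) j ≡ nth xs j
nth-++ˡ (x ∷ xs) ys zero    _         = refl
nth-++ˡ (x ∷ xs) ys (suc j) (s≤s j<n) = nth-++ˡ xs ys j j<n

nth-++ʳ : ∀ xs ys j → nth (xs ++ ys) (length xs ℕ.+ j) ≡ nth ys j
nth-++ʳ []       ys j = refl
nth-++ʳ (x ∷ xs) ys j = nth-++ʳ xs ys j

module _ {m} (x y : ℕ) (k l : Vec ℕ (suc m)) where

  nth-aList-∷-< : ∀ j → j < suc (2 ℕ.* m) → nth (aList (x ∷ k) (y ∷ l)) j ≡ nth (aList k l) j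
  nth-aList-∷-< j j<J rewrite aList-∷ x y k l =
    nth-++ˡ (aList k l) _ j (subst (j <_) (sym (aList-length m k l)) j<J)

  nth-aList-∷-at : ∀ i → nth (aList (x ∷ k) (y ∷ l)) (suc (2 ℕ.* m) ℕ.+ i) ≡ nth (y ∷ x ∷ []) i
  nth-aList-∷-at i rewrite aList-∷ x y k l =
    trans (cong (λ n → nth (aList k l ++ y ∷ x ∷ []) (n ℕ.+ i)) (sym (aList-length m k l)))
          (nth-++ʳ (aList k l) _ i)

isEven-2* : ∀ m → isEven (2 ℕ.* m) ≡ true
isEven-2* zero    = refl
isEven-2* (suc m) rewrite 2*suc m = isEven-2* m

isEven-1+2* : ∀ m → isEven (suc (2 ℕ.* m)) ≡ false
isEven-1+2* m = trans (isEven-suc (2 ℕ.* m)) (cong not (isEven-2* m))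

Agrees : (ℕ → ℕ) → List ℕ → ℕ → Set
Agrees a xs J = ∀ j → j < J → a j ≡ nth xs j

PositiveTail : ∀ {m} → Vec ℕ (suc m) → Set
PositiveTail {m} k = ∀ (i : Fin (suc m)) → i ≢ zero → 1 ≤ lookup k i

PositiveInit : ∀ {m} → Vec ℕ (suc m) → Set
PositiveInit {m} l = ∀ (i : Fin (suc m)) → toℕ i < m → 1 ≤ lookup l i

-- Peel off the first two runs 1^{k₁} 0^{l₁} of the creation sequence; they
-- contribute the last two terms l₁, k₁ of a.
factorisation-ones : ∀ m a₀ (k : Vec ℕ m) (l : Vec ℕ (suc m)) →
  PositiveTail (suc a₀ ∷ k) → PositiveInit l →
  ∀ a → Agrees a (aList (suc a₀ ∷ k) l) (suc (2 ℕ.* m)) →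
  Factorisation a (runs (suc a₀ ∷ k) l) (suc (2 ℕ.* m))
factorisation-ones zero a₀ [] (zero ∷ []) _ _ a agrees =
  subst (λ s → Factorisation a s 1) (sym (List.++-identityʳ (replicate (suc a₀) true ++ [])))
    (Factorisation-ones a a₀ (agrees 0 (s≤s z≤n)))
factorisation-ones zero a₀ [] (suc b ∷ []) _ _ a agrees =
  subst (λ s → Factorisation a s 1) (sym (List.++-assoc (replicate (suc a₀) true) (replicate (suc b) false) []))
    (Factorisation-run a true (replicate b false ++ []) 0 a₀ (Factorisation-zeros a b) (agrees 0 (s≤s z≤n)) refl)
factorisation-ones (suc m) a₀ (zero ∷ k) (b ∷ l) positiveK _ _ _ =
  ⊥-elim (ℕ.<-irrefl refl (positiveK (suc zero) λ ()))
factorisation-ones (suc m) a₀ (suc c ∷ k) (zero ∷ l) _ positiveL _ _ =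
  ⊥-elim (ℕ.<-irrefl refl (positiveL zero (s≤s z≤n)))
factorisation-ones (suc m) a₀ (suc c ∷ k) (suc b ∷ l₀ ∷ l) positiveK positiveL a agrees rewrite 2*suc m =
  subst (λ s → Factorisation a s (suc (suc (suc (2 ℕ.* m)))))
    (sym (List.++-assoc (replicate (suc a₀) true) (replicate (suc b) false) (runs (suc c ∷ k) (l₀ ∷ l))))
    (Factorisation-run a true _ (suc (suc (2 ℕ.* m))) a₀
      (Factorisation-run a false _ (suc (2 ℕ.* m)) b
        (factorisation-ones m c k (l₀ ∷ l) (λ i _ → positiveK (suc i) λ ()) (λ i i<m → positiveL (suc i) (s≤s i<m)) a
          λ j j<J → trans (agrees j (ℕ.m<n⇒m<1+n (ℕ.m<n⇒m<1+n j<J)))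
                          (nth-aList-∷-< (suc a₀) (suc b) (suc c ∷ k) (l₀ ∷ l) j j<J))
        a-odd
        (isEven-1+2* m))
      a-even
      (isEven-2* m))
  where
  big = aList (suc a₀ ∷ suc c ∷ k) (suc b ∷ l₀ ∷ l)
  a-odd : a (suc (2 ℕ.* m)) ≡ suc b
  a-odd = trans (agrees _ (ℕ.m<n⇒m<1+n (ℕ.n<1+n _)))
            (trans (cong (nth big) (sym (ℕ.+-identityʳ _))) (nth-aList-∷-at (suc a₀) (suc b) (suc c ∷ k) (l₀ ∷ l) 0))
  a-even : a (suc (suc (2 ℕ.* m))) ≡ suc a₀
  a-even = trans (agrees _ (ℕ.n<1+n _))
             (trans (cong (nth big) (cong suc (ℕ.+-comm 1 (2 ℕ.* m)))) (nth-aList-∷-at (suc a₀) (suc b) (suc c ∷ k) (l₀ ∷ l) 1))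

factorisation-zeros : ∀ m b (k l : Vec ℕ m) →
  PositiveTail (zero ∷ k) → PositiveInit (suc b ∷ l) → 2 ≤ length (runs (zero ∷ k) (suc b ∷ l)) →
  ∀ a → Agrees a (aList (zero ∷ k) (suc b ∷ l)) (2 ℕ.* m) →
  Factorisation a (runs (zero ∷ k) (suc b ∷ l)) (2 ℕ.* m)
factorisation-zeros zero    zero     []            []       _ _ (s≤s ()) _ _
factorisation-zeros zero    (suc b)  []            []       _ _ _        a _ = Factorisation-zeros a (suc b)
factorisation-zeros (suc m) b        (zero ∷ k)    l        positiveK _ _ _ _ =
  ⊥-elim (ℕ.<-irrefl refl (positiveK (suc zero) λ ()))
factorisation-zeros (suc m) b        (suc c ∷ k)   (l₀ ∷ l) positiveK positiveL _ a agrees rewrite 2*suc m =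
  Factorisation-run a false _ (suc (2 ℕ.* m)) b
    (factorisation-ones m c k (l₀ ∷ l) (λ i _ → positiveK (suc i) λ ()) (λ i i<m → positiveL (suc i) (s≤s i<m)) a
      λ j j<J → trans (agrees j (ℕ.m<n⇒m<1+n j<J)) (nth-aList-∷-< zero (suc b) (suc c ∷ k) (l₀ ∷ l) j j<J))
    (trans (agrees _ (ℕ.n<1+n _))
      (trans (cong (nth (aList (zero ∷ suc c ∷ k) (suc b ∷ l₀ ∷ l))) (sym (ℕ.+-identityʳ _)))
             (nth-aList-∷-at zero (suc b) (suc c ∷ k) (l₀ ∷ l) 0)))
    (isEven-1+2* m)

factorisation : ∀ m (k l : Vec ℕ (suc m)) → PositiveTail k → PositiveInit l → 2 ≤ length (runs k l) →
  Factorisation (nth (aList k l)) (runs k l) (Jdim (runs k l) m)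
factorisation m (suc a₀ ∷ k) (b ∷ l) positiveK positiveL _ =
  subst (Factorisation _ _) (ℕ.+-comm 1 (2 ℕ.* m))
    (factorisation-ones m a₀ k (b ∷ l) positiveK positiveL _ λ _ _ → refl)
factorisation m (zero ∷ k) (suc b ∷ l) positiveK positiveL length≥2 =
  subst (Factorisation _ _) (sym (ℕ.+-identityʳ (2 ℕ.* m)))
    (factorisation-zeros m b k l positiveK positiveL length≥2 _ λ _ _ → refl)
factorisation zero    (zero ∷ []) (zero ∷ []) _ _ ()
factorisation (suc m) (zero ∷ k)  (zero ∷ l)  _ positiveL _ = ⊥-elim (ℕ.<-irrefl refl (positiveL zero (s≤s z≤n)))

theorem2 : (s : List Bool) → 2 ≤ length s →
    (m' : ℕ) (k l : Vec ℕ (suc m')) →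
    (∀ (i : Fin (suc m')) → i ≢ zero → 1 ≤ lookup k i) →
    (∀ (i : Fin (suc m')) → toℕ i < m' → 1 ≤ lookup l i) →
    s ≡ runs k l →
    (charPoly (adjTilde s)
       ≈P Xpow (length s ∸ Jdim s m') *P charPoly (Bmat {J = Jdim s m'} k l))
    × (coeff (charPoly (Bmat {J = Jdim s m'} k l)) 0 ≢ + 0)
theorem2 s length≥2 m' k l positiveK positiveL refl =
  coeff-≡ (≋-trans (χA≋ F) (*P-cong (≋-refl {Xpow (length s ∸ J)}) (≋-sym charPolyB≋χ))) ,
  λ eq → coeff₀-χ≢0 a J (positive F) (trans (sym (coeff-≡ charPolyB≋χ 0)) eq)
  where
  a = nth (aList k l)
  J = Jdim s m'
  F = factorisation m' k l positiveK positiveL length≥2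
  charPolyB≋χ : charPoly (Bmat {J = J} k l) ≋ χ a J
  charPolyB≋χ = ≋-trans (charPoly-Bmat {J = J} k l) (det-charEntry a J)
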